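{- Let $f(x)=a_0(x-a_1)\cdots(x-a_k)$ with $a_0\in\mathbb{Q}\setminus\{0\}$, $k\ge 1$ and $a_1,\dots,a_k$ distinct rationals, and let $g(x)\in\mathbb{Q}[x]$. Suppose that the equation $f(x)=g(y)$ has infinitely many rational solutions with a bounded denominator, and that $f=\varphi(F(\kappa))$ and $g=\varphi(G(\lambda))$, where $\kappa,\lambda\in\mathbb{Q}[x]$ are linear polynomials, $\varphi\in\mathbb{Q}[x]$, and $(F,G)$ is a standard pair over $\mathbb{Q}$ such that the equation $F(x)=G(y)$ has infinitely many rational solutions with a bounded denominator. Then one of the following holds: (1) $(F,G)$ is a standard pair of the first or second kind and $\min(\deg(F),\deg(G))\le 2$; (2) $(F,G)$ is a standard pair of the third or fourth kind.
   Context: An equation $P(x)=Q(y)$ has infinitely many rational solutions with a bounded denominator if there is a positive integer $\Delta$ such that there are infinitely many $(x,y)\in\mathbb{Q}^2$ with $P(x)=Q(y)$ and $(\Delta x,\Delta y)\in\mathbb{Z}^2$. For nonzero $\delta\in\mathbb{Q}$ and positive integer $\mu$, the Dickson polynomial is $D_\mu(x,\delta)=\sum_{i=0}^{\lfloor \mu/2\rfloor}\frac{\mu}{\mu-i}\binom{\mu-i}{i}(-\delta)^i x^{\mu-2i}$. Polynomials $F,G\in\mathbb{Q}[x]$ form a standard pair over $\mathbb{Q}$ if $(F,G)$ or $(G,F)$ is one of the following, where $\alpha,\beta$ are nonzero rationals, $\mu,\nu,q$ positive integers, $p$ a non-negative integer and $v\in\mathbb{Q}[x]$ a nonzero (possibly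 constant) polynomial: first kind: $(x^q,\alpha x^p v(x)^q)$ with $0\le p<q$, $\gcd(p,q)=1$, $p+\deg(v)>0$; second kind: $(x^2,(\alpha x^2+\beta)v(x)^2)$; third kind: $(D_\mu(x,\alpha^\nu),D_\nu(x,\alpha^\mu))$ with $\gcd(\mu,\nu)=1$; fourth kind: $(\alpha^{ -\mu/2}D_\mu(x,\alpha),-\beta^{ -\nu/2}D_\nu(x,\beta))$ with $\gcd(\mu,\nu)=2$; fifth kind: $((\alpha x^2-1)^3,3x^4-4x^3)$. -}

module Defs where

open import Data.Nat as ℕ using (ℕ; zero; suc; _∸_; _≤_; _<_)
open import Data.Nat.GCD using (gcd)
open import Data.Nat.Combinatorics using (_C_)
open import Data.Integer as ℤ using (ℤ; +_)
open import Data.Rational using (ℚ; 0ℚ; 1ℚ; _+_; _*_; -_; _-_; 1/_; ≢-nonZero)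
import Data.Rational as ℚ
open import Data.Rational.Properties using (_≟_)
open import Data.List using (List; []; _∷_; replicate; _++_; foldr; upTo; map)
open import Data.Product using (Σ; ∃; _×_; _,_)
open import Data.Sum using (_⊎_)
open import Data.Fin using (Fin)
open import Relation.Nullary using (¬_; yes; no)
open import Relation.Binary.PropositionalEquality using (_≡_; _≢_)
open import Data.List.Membership.Propositional using (_∉_)

_^ℚ_ : ℚ → ℕ → ℚ
q ^ℚ zero  = 1ℚ
q ^ℚ suc n = q * (q ^ℚ n)

-- total inverse (inv 0 = 0); only ever applied to nonzero arguments
inv : ℚ → ℚ
inv q with q ≟ 0ℚ
... | yes _ = 0ℚ
... | no q≢0 = 1/_ q {{≢-nonZero q≢0}}

IsInt : ℚ → Set
IsInt q = ∃ λ (z : ℤ) → q ≡ z ℚ./ 1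

-- Polynomials over ℚ as coefficient lists (constant term first).
-- Trailing zeros are allowed; equality is coefficientwise (≈P).

Poly : Set
Poly = List ℚ

coeff : Poly → ℕ → ℚ
coeff []       _       = 0ℚ
coeff (a ∷ p)  zero    = a
coeff (a ∷ p)  (suc n) = coeff p n

infix 4 _≈P_
_≈P_ : Poly → Poly → Set
p ≈P q = ∀ n → coeff p n ≡ coeff q n

zeroP : Poly
zeroP = []

constP : ℚ → Poly
constP c = c ∷ []

X : Poly
X = 0ℚ ∷ 1ℚ ∷ []

infixl 6 _+P_
_+P_ : Poly → Poly → Poly
[]      +P q       = q
(a ∷ p) +P []      = a ∷ p
(a ∷ p) +P (b ∷ q) = (a + b) ∷ (p +P q)

scaleP : ℚ → Poly → Poly
scaleP c = map (c *_)

negP : Poly → Poly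
negP = scaleP (- 1ℚ)

infixl 7 _*P_
_*P_ : Poly → Poly → Poly
[]      *P q = []
(a ∷ p) *P q = scaleP a q +P (0ℚ ∷ (p *P q))

infixr 8 _^P_
_^P_ : Poly → ℕ → Poly
p ^P zero  = constP 1ℚ
p ^P suc n = p *P (p ^P n)

-- composition: compP p q = p(q(x))  (Horner)
compP : Poly → Poly → Poly
compP []      q = []
compP (a ∷ p) q = constP a +P (q *P compP p q)

evalP : Poly → ℚ → ℚ
evalP []      x = 0ℚ
evalP (a ∷ p) x = a + x * evalP p x

allZero : Poly → Set
allZero p = p ≈P zeroP

-- degree (the zero polynomial is given degree 0)
deg : Poly → ℕ
deg [] = 0
deg (a ∷ p) with deg p | isZ p
  where
    isZ : Poly → ℕ
    isZ [] = 0
    isZ (b ∷ r) with b ≟ 0ℚ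
    ... | yes _ = isZ r
    ... | no _  = 1
... | d | zero  = 0
... | d | suc _ = suc d

-- Dickson polynomial D_μ(x,δ) = Σ_{i=0}^{⌊μ/2⌋} μ/(μ-i) · C(μ-i,i) · (-δ)^i x^{μ-2i}

monomial : ℚ → ℕ → Poly
monomial c n = replicate n 0ℚ ++ (c ∷ [])

-- μ/(μ-i) · C(μ-i,i) as a rational (μ-i ≥ 1 in the relevant range)
dicksonCoeff : ℕ → ℕ → ℚ
dicksonCoeff μ i with μ ∸ i
... | zero  = 0ℚ
... | suc k = ((+ μ) ℚ./ suc k) * ((+ ((μ ∸ i) C i)) ℚ./ 1)

Dickson : ℕ → ℚ → Poly
Dickson μ δ =
  foldr (λ i acc → monomial (dicksonCoeff μ i * ((- δ) ^ℚ i)) (μ ∸ (2 ℕ.* i)) +P acc)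
        zeroP (upTo (suc (μ ℕ./ 2)))

-- Standard pairs (F,G) of the five kinds (ordered versions)

Kind1 : Poly → Poly → Set
Kind1 F G = Σ ℚ λ α → Σ ℕ λ q → Σ ℕ λ p → Σ Poly λ v →
  α ≢ 0ℚ × 0 < q × p < q × gcd p q ≡ 1 × ¬ (v ≈P zeroP) × 0 < p ℕ.+ deg v ×
  F ≈P X ^P q × G ≈P scaleP α (X ^P p *P v ^P q)

Kind2 : Poly → Poly → Set
Kind2 F G = Σ ℚ λ α → Σ ℚ λ β → Σ Poly λ v →
  α ≢ 0ℚ × β ≢ 0ℚ × ¬ (v ≈P zeroP) ×
  F ≈P X ^P 2 × G ≈P (scaleP α (X ^P 2) +P constP β) *P v ^P 2

Kind3 : Poly → Poly → Set
Kind3 F G = Σ ℚ λ α → Σ ℕ λ μ → Σ ℕ λ ν →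
  α ≢ 0ℚ × 0 < μ × 0 < ν × gcd μ ν ≡ 1 ×
  F ≈P Dickson μ (α ^ℚ ν) × G ≈P Dickson ν (α ^ℚ μ)

-- α^{-μ/2} with μ even is written inv (α ^ℚ (μ / 2))
Kind4 : Poly → Poly → Set
Kind4 F G = Σ ℚ λ α → Σ ℚ λ β → Σ ℕ λ μ → Σ ℕ λ ν →
  α ≢ 0ℚ × β ≢ 0ℚ × 0 < μ × 0 < ν × gcd μ ν ≡ 2 ×
  F ≈P scaleP (inv (α ^ℚ (μ ℕ./ 2))) (Dickson μ α) ×
  G ≈P scaleP (- inv (β ^ℚ (ν ℕ./ 2))) (Dickson ν β)

Kind5 : Poly → Poly → Set
Kind5 F G = Σ ℚ λ α → α ≢ 0ℚ ×
  F ≈P (scaleP α (X ^P 2) +P constP (- 1ℚ)) ^P 3 ×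
  G ≈P scaleP ((+ 3) ℚ./ 1) (X ^P 4) +P scaleP (- ((+ 4) ℚ./ 1)) (X ^P 3)

Sym : (Poly → Poly → Set) → Poly → Poly → Set
Sym K F G = K F G ⊎ K G F

StdPair1 StdPair2 StdPair3 StdPair4 StdPair5 : Poly → Poly → Set
StdPair1 = Sym Kind1
StdPair2 = Sym Kind2
StdPair3 = Sym Kind3
StdPair4 = Sym Kind4
StdPair5 = Sym Kind5

StandardPair : Poly → Poly → Set
StandardPair F G =
  StdPair1 F G ⊎ StdPair2 F G ⊎ StdPair3 F G ⊎ StdPair4 F G ⊎ StdPair5 F G

-- P(x) = Q(y) has infinitely many rational solutions with a bounded
-- denominator: ∃ Δ ≥ 1 such that the solution set
-- { (x,y) ∈ ℚ² | P(x) = Q(y), Δx ∈ ℤ, Δy ∈ ℤ } is infinite, i.e. no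
-- finite list exhausts it.

Sol : Poly → Poly → ℕ → ℚ × ℚ → Set
Sol P Q Δ (x , y) =
  evalP P x ≡ evalP Q y × IsInt (((+ Δ) ℚ./ 1) * x) × IsInt (((+ Δ) ℚ./ 1) * y)

InfManyBoundedDenom : Poly → Poly → Set
InfManyBoundedDenom P Q = Σ ℕ λ Δ → 0 < Δ ×
  ((L : List (ℚ × ℚ)) → Σ (ℚ × ℚ) λ s → Sol P Q Δ s × s ∉ L)

prodLin : (k : ℕ) → (Fin k → ℚ) → Poly
prodLin zero    a = constP 1ℚ
prodLin (suc k) a = (X +P constP (- a Fin.zero)) *P prodLin k (λ i → a (Fin.suc i))
  where import Data.Fin as Fin

fPoly : ℚ → (k : ℕ) → (Fin k → ℚ) → Poly
fPoly a₀ k a = scaleP a₀ (prodLin k a)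

minℕ : ℕ → ℕ → ℕ
minℕ = ℕ._⊓_

-- f = a₀ (x - a₁) ⋯ (x - a_k) has deg f distinct rational roots, and f = φ ∘ H with H = F ∘ κ. The
-- values of H at these roots are roots of φ, and counting degrees shows that some fibre H = c contains
-- deg H of them: H - c = ℓ (x - r₁) ⋯ (x - r_M) with distinct rational rᵢ. Then H′(rᵢ) = ℓ wᵢ with
-- wᵢ = ∏_{j ≠ i} (rᵢ - rⱼ), and Lagrange interpolation gives Σᵢ P(rᵢ) / wᵢ = 0 whenever deg P ≤ M - 2.
-- If H = W V³ with V nonconstant, then H′ = V² P with deg P ≤ M - 2, and every term ℓ P(rᵢ) / wᵢ
-- equals ℓ² / V(rᵢ)² > 0, a contradiction; so F has no such cube factor. But F = x^q with q ≥ 3,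
-- F = α x^p v^q with q ≥ 3 and deg F ≥ 3, F = (α x² - 1)³ and F = x³ (3x - 4) all have one, which
-- rules out every standard pair not listed in the conclusion.

module Submission where

open import Defs
open import Data.Nat as ℕ using (ℕ; zero; suc; _≤_; _<_; _⊓_; z≤n; s≤s)
import Data.Nat.Properties as ℕₚ
open import Data.Nat.Solver using (module +-*-Solver)
open +-*-Solver using () renaming (solve to ℕ-solve; _:+_ to _⊕_; _:=_ to _⊜_; con to ncon)
import Data.Nat.Coprimality as Coprime
import Data.Integer as ℤ
import Data.Integer.Properties as ℤₚ
open import Data.Rational using (ℚ; 0ℚ; 1ℚ; _+_; _*_; -_; _-_; mkℚ; ↥_)
import Data.Rational as ℚ
import Data.Rational.Properties as ℚₚ
import Data.Rational.Solver as ℚ-Solver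
open ℚ-Solver.+-*-Solver using (solve; _:+_; _:*_; :-_; _:-_; _:=_; con)
open import Data.List using (List; []; _∷_; length; map; filter; take; tabulate)
import Data.List.Properties as Listₚ
open import Data.List.Relation.Unary.All as All using (All; []; _∷_)
import Data.List.Relation.Unary.All.Properties as Allₚ
open import Data.List.Relation.Unary.Any using (here; there)
open import Data.List.Relation.Unary.Unique.Propositional using (Unique; []; _∷_)
import Data.List.Relation.Unary.Unique.Propositional.Properties as Uniqueₚ
open import Data.List.Membership.Propositional using (_∈_; _∉_)
open import Data.List.Membership.Propositional.Properties using (∈-map⁺; ∈-map⁻)
open import Data.List.Relation.Binary.Permutation.Propositional as ↭ using (_↭_; ↭-sym; ↭⇒↭ₛ)
open import Data.List.Relation.Binary.Permutation.Propositional.Properties using (↭-length)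
import Data.List.Relation.Binary.Permutation.Setoid.Properties as ↭ₛ
open import Data.Fin as Fin using (Fin; toℕ)
import Data.Fin.Properties as Finₚ
open import Data.Product using (Σ; _×_; _,_; proj₂; map₂)
open import Data.Sum using (_⊎_; inj₁; inj₂)
open import Data.Empty using (⊥; ⊥-elim)
open import Function using (_∘_)
open import Function.Definitions using (Injective)
open import Relation.Nullary using (¬_; Dec; yes; no)
open import Relation.Unary using (Decidable)
open import Relation.Unary.Properties using (∁?)
open import Relation.Binary using (tri<; tri≈; tri>)
open import Relation.Binary.PropositionalEquality
  using (_≡_; _≢_; refl; sym; trans; cong; cong₂; subst; setoid; module ≡-Reasoning)

private
  variable
    a b c s x y : ℚ
    m n : ℕ
    p q : Poly
    rs t : List ℚ

inv-inverseˡ : x ≢ 0ℚ → inv x * x ≡ 1ℚ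
inv-inverseˡ {x} x≢0 with x ℚₚ.≟ 0ℚ
... | yes x≡0 = ⊥-elim (x≢0 x≡0)
... | no x≢0′ = ℚₚ.*-inverseˡ x {{ℚ.≢-nonZero x≢0′}}

x*y≡0⇒y≡0 : x * y ≡ 0ℚ → x ≢ 0ℚ → y ≡ 0ℚ
x*y≡0⇒y≡0 {x} {y} xy≡0 x≢0 = begin
  y                 ≡⟨ sym (ℚₚ.*-identityˡ y) ⟩
  1ℚ * y            ≡⟨ cong (_* y) (sym (inv-inverseˡ x≢0)) ⟩
  (inv x * x) * y   ≡⟨ ℚₚ.*-assoc (inv x) x y ⟩
  inv x * (x * y)   ≡⟨ cong (inv x *_) xy≡0 ⟩
  inv x * 0ℚ        ≡⟨ ℚₚ.*-zeroʳ (inv x) ⟩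
  0ℚ                ∎
  where open ≡-Reasoning

*-≢0 : x ≢ 0ℚ → y ≢ 0ℚ → x * y ≢ 0ℚ
*-≢0 x≢0 y≢0 xy≡0 = y≢0 (x*y≡0⇒y≡0 xy≡0 x≢0)

^ℚ-≢0 : x ≢ 0ℚ → x ^ℚ n ≢ 0ℚ
^ℚ-≢0 {n = zero}  _   ()
^ℚ-≢0 {n = suc n} x≢0 = *-≢0 x≢0 (^ℚ-≢0 {n = n} x≢0)

^ℚ-+ : ∀ x m n → x ^ℚ (m ℕ.+ n) ≡ x ^ℚ m * x ^ℚ n
^ℚ-+ x zero    n = sym (ℚₚ.*-identityˡ _)
^ℚ-+ x (suc m) n = trans (cong (x *_) (^ℚ-+ x m n)) (sym (ℚₚ.*-assoc x _ _))

x-y≡0⇒x≡y : x - y ≡ 0ℚ → x ≡ y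
x-y≡0⇒x≡y {x} {y} x-y≡0 = begin
  x              ≡⟨ solve 2 (λ x y → x := (x :- y) :+ y) refl x y ⟩
  (x - y) + y    ≡⟨ cong (_+ y) x-y≡0 ⟩
  0ℚ + y         ≡⟨ ℚₚ.+-identityˡ y ⟩
  y              ∎
  where open ≡-Reasoning

fromℕ : ℕ → ℚ
fromℕ n = mkℚ (ℤ.+ n) 0 (Coprime.sym (Coprime.1-coprimeTo n))

fromℕ-injective : Injective _≡_ _≡_ fromℕ
fromℕ-injective e = ℤₚ.+-injective (cong ↥_ e)

square-pos : x ≢ 0ℚ → 0ℚ ℚ.< x * x
square-pos {x} x≢0 with ℚₚ.<-cmp x 0ℚ
... | tri< x<0 _ _ = ℚₚ.positive⁻¹ (x * x) {{ℚₚ.neg*neg⇒pos x {{ℚ.negative x<0}} x {{ℚ.negative x<0}}}}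
... | tri≈ _ x≡0 _ = ⊥-elim (x≢0 x≡0)
... | tri> _ _ x>0 = ℚₚ.positive⁻¹ (x * x) {{ℚₚ.pos*pos⇒pos x {{ℚ.positive x>0}} x {{ℚ.positive x>0}}}}

square-nonneg : ∀ x → 0ℚ ℚ.≤ x * x
square-nonneg x with x ℚₚ.≟ 0ℚ
... | yes refl = ℚₚ.≤-refl
... | no x≢0   = ℚₚ.<⇒≤ (square-pos x≢0)

pos-of-*-nonneg : 0ℚ ℚ.≤ y → 0ℚ ℚ.< x * y → 0ℚ ℚ.< x
pos-of-*-nonneg {y} {x} y≥0 xy>0 with ℚₚ.<-cmp x 0ℚ
... | tri> _ _ x>0 = x>0
... | tri≈ _ refl _ = ⊥-elim (ℚₚ.<-irrefl (sym (ℚₚ.*-zeroˡ y)) xy>0)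
... | tri< x<0 _ _ = ⊥-elim (ℚₚ.<-irrefl refl (ℚₚ.<-≤-trans xy>0 (ℚₚ.nonPositive⁻¹ (x * y)
  {{ℚₚ.nonPos*nonNeg⇒nonPos x {{ℚ.nonPositive (ℚₚ.<⇒≤ x<0)}} y {{ℚ.nonNegative y≥0}}}})))

coeff-+ : ∀ p q n → coeff (p +P q) n ≡ coeff p n + coeff q n
coeff-+ []      q       n       = sym (ℚₚ.+-identityˡ _)
coeff-+ (a ∷ p) []      n       = sym (ℚₚ.+-identityʳ _)
coeff-+ (a ∷ p) (b ∷ q) zero    = refl
coeff-+ (a ∷ p) (b ∷ q) (suc n) = coeff-+ p q n

coeff-scale : ∀ c p n → coeff (scaleP c p) n ≡ c * coeff p n
coeff-scale c []      n       = sym (ℚₚ.*-zeroʳ c)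
coeff-scale c (a ∷ p) zero    = refl
coeff-scale c (a ∷ p) (suc n) = coeff-scale c p n

infixl 6 _-P_
_-P_ : Poly → Poly → Poly
p -P q = p +P negP q

coeff-sub : ∀ p q n → coeff (p -P q) n ≡ coeff p n - coeff q n
coeff-sub p q n = trans (coeff-+ p (negP q) n) (cong (coeff p n +_) (trans (coeff-scale (- 1ℚ) q n)
  (solve 1 (λ b → :- con 1ℚ :* b := :- b) refl (coeff q n))))

allZero-sub⇒≈ : allZero (p -P q) → p ≈P q
allZero-sub⇒≈ {p} {q} z n = x-y≡0⇒x≡y (trans (sym (coeff-sub p q n)) (z n))

evalP-+ : ∀ p q x → evalP (p +P q) x ≡ evalP p x + evalP q x
evalP-+ []      q       x = sym (ℚₚ.+-identityˡ _)
evalP-+ (a ∷ p) []      x = sym (ℚₚ.+-identityʳ _)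
evalP-+ (a ∷ p) (b ∷ q) x rewrite evalP-+ p q x =
  solve 5 (λ a b x P Q → (a :+ b) :+ x :* (P :+ Q) := (a :+ x :* P) :+ (b :+ x :* Q)) refl
    a b x (evalP p x) (evalP q x)

evalP-scale : ∀ c p x → evalP (scaleP c p) x ≡ c * evalP p x
evalP-scale c []      x = sym (ℚₚ.*-zeroʳ c)
evalP-scale c (a ∷ p) x rewrite evalP-scale c p x =
  solve 4 (λ c a x P → c :* a :+ x :* (c :* P) := c :* (a :+ x :* P)) refl c a x (evalP p x)

evalP-sub : ∀ p q x → evalP (p -P q) x ≡ evalP p x - evalP q x
evalP-sub p q x = trans (evalP-+ p (negP q) x) (cong (evalP p x +_) (trans (evalP-scale (- 1ℚ) q x)
  (solve 1 (λ b → :- con 1ℚ :* b := :- b) refl (evalP q x))))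

evalP-* : ∀ p q x → evalP (p *P q) x ≡ evalP p x * evalP q x
evalP-* []      q x = sym (ℚₚ.*-zeroˡ (evalP q x))
evalP-* (a ∷ p) q x rewrite evalP-+ (scaleP a q) (0ℚ ∷ (p *P q)) x | evalP-scale a q x | evalP-* p q x =
  solve 4 (λ a x P Q → a :* Q :+ (con 0ℚ :+ x :* (P :* Q)) := (a :+ x :* P) :* Q) refl
    a x (evalP p x) (evalP q x)

evalP-const : ∀ c x → evalP (constP c) x ≡ c
evalP-const c x = solve 2 (λ c x → c :+ x :* con 0ℚ := c) refl c x

evalP-X : ∀ x → evalP X x ≡ x
evalP-X x = solve 1 (λ x → con 0ℚ :+ x :* (con 1ℚ :+ x :* con 0ℚ) := x) refl x

evalP-comp : ∀ p q x → evalP (compP p q) x ≡ evalP p (evalP q x)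
evalP-comp []      q x = refl
evalP-comp (a ∷ p) q x
  rewrite evalP-+ (constP a) (q *P compP p q) x | evalP-const a x
        | evalP-* q (compP p q) x | evalP-comp p q x = refl

evalP-^ : ∀ p n x → evalP (p ^P n) x ≡ evalP p x ^ℚ n
evalP-^ p zero    x = evalP-const 1ℚ x
evalP-^ p (suc n) x rewrite evalP-* p (p ^P n) x | evalP-^ p n x = refl

evalP-X^ : ∀ n x → evalP (X ^P n) x ≡ x ^ℚ n
evalP-X^ n x = trans (evalP-^ X n x) (cong (_^ℚ n) (evalP-X x))

evalP-allZero : ∀ p x → allZero p → evalP p x ≡ 0ℚ
evalP-allZero []      x z = refl
evalP-allZero (a ∷ p) x z rewrite z 0 | evalP-allZero p x (z ∘ suc) =
  solve 1 (λ x → con 0ℚ :+ x :* con 0ℚ := con 0ℚ) refl x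

evalP-cong : ∀ {p q} x → p ≈P q → evalP p x ≡ evalP q x
evalP-cong {[]}    {q}     x e = sym (evalP-allZero q x (sym ∘ e))
evalP-cong {a ∷ p} {[]}    x e = evalP-allZero (a ∷ p) x e
evalP-cong {a ∷ p} {b ∷ q} x e rewrite e 0 | evalP-cong {p} {q} x (e ∘ suc) = refl

record DegLe (p : Poly) (n : ℕ) : Set where
  constructor degLe
  field vanishes : ∀ m → n < m → coeff p m ≡ 0ℚ

open DegLe

Deg : Poly → ℕ → Set
Deg p n = coeff p n ≢ 0ℚ × DegLe p n

DegLe-tail : DegLe (a ∷ p) (suc n) → DegLe p n
DegLe-tail d = degLe (λ m n<m → vanishes d (suc m) (s≤s n<m))

DegLe0-tail : DegLe (a ∷ p) 0 → allZero p
DegLe0-tail d m = vanishes d (suc m) (s≤s z≤n)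

DegLe-mono : m ≤ n → DegLe p m → DegLe p n
DegLe-mono m≤n d = degLe (λ k n<k → vanishes d k (ℕₚ.≤-<-trans m≤n n<k))

DegLe-≈ : p ≈P q → DegLe p n → DegLe q n
DegLe-≈ p≈q d = degLe (λ k n<k → trans (sym (p≈q k)) (vanishes d k n<k))

Deg-≈ : p ≈P q → Deg p n → Deg q n
Deg-≈ {n = n} p≈q (lead≢0 , d) = (λ e → lead≢0 (trans (p≈q n) e)) , DegLe-≈ p≈q d

Deg-unique : Deg p m → Deg p n → m ≡ n
Deg-unique {m = m} {n = n} (lead≢0 , d) (lead≢0′ , d′) with ℕₚ.<-cmp m n
... | tri< m<n _ _ = ⊥-elim (lead≢0′ (vanishes d n m<n))
... | tri≈ _ m≡n _ = m≡n
... | tri> _ _ n<m = ⊥-elim (lead≢0 (vanishes d′ m n<m))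

allZero⊎Deg : ∀ p → allZero p ⊎ Σ ℕ (Deg p)
allZero⊎Deg []      = inj₁ (λ _ → refl)
allZero⊎Deg (a ∷ p) with allZero⊎Deg p
... | inj₂ (n , lead≢0 , d) = inj₂ (suc n , lead≢0 , degLe λ { (suc m) (s≤s n<m) → vanishes d m n<m })
... | inj₁ z with a ℚₚ.≟ 0ℚ
...   | yes a≡0 = inj₁ (λ { zero → a≡0 ; (suc m) → z m })
...   | no a≢0  = inj₂ (0 , a≢0 , degLe λ { (suc m) _ → z m })

coeff≥length : ∀ p → length p ≤ m → coeff p m ≡ 0ℚ
coeff≥length []      _         = refl
coeff≥length (a ∷ p) (s≤s l≤m) = coeff≥length p l≤m

DegLe-+ : DegLe p n → DegLe q n → DegLe (p +P q) n
DegLe-+ {p} {n} {q} dp dq = degLe λ m n<m →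
  trans (coeff-+ p q m) (trans (cong₂ _+_ (vanishes dp m n<m) (vanishes dq m n<m)) (ℚₚ.+-identityˡ 0ℚ))

DegLe-scale : ∀ c → DegLe p n → DegLe (scaleP c p) n
DegLe-scale {p} c d = degLe λ m n<m →
  trans (coeff-scale c p m) (trans (cong (c *_) (vanishes d m n<m)) (ℚₚ.*-zeroʳ c))

DegLe-const : ∀ c → DegLe (constP c) 0
DegLe-const c = degLe λ { (suc m) _ → refl }

DegLe-X : DegLe X 1
DegLe-X = degLe λ { (suc (suc m)) _ → refl ; (suc zero) (s≤s ()) }

Deg-X : Deg X 1
Deg-X = (λ ()) , DegLe-X

Deg-const : c ≢ 0ℚ → Deg (constP c) 0
Deg-const c≢0 = c≢0 , DegLe-const _

Deg-scale : c ≢ 0ℚ → Deg p n → Deg (scaleP c p) n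
Deg-scale {c} {p} {n} c≢0 (lead≢0 , d) =
  (λ e → *-≢0 c≢0 lead≢0 (trans (sym (coeff-scale c p n)) e)) , DegLe-scale c d

Deg-+ˡ : Deg p (suc n) → DegLe q n → Deg (p +P q) (suc n)
Deg-+ˡ {p} {n} {q} (lead≢0 , dp) dq =
  (λ e → lead≢0 (trans (sym (ℚₚ.+-identityʳ _))
    (trans (cong (coeff p (suc n) +_) (sym (vanishes dq (suc n) ℕₚ.≤-refl)))
    (trans (sym (coeff-+ p q (suc n))) e)))) ,
  DegLe-+ dp (DegLe-mono (ℕₚ.n≤1+n n) dq)

allZero-*ˡ : ∀ p q → allZero p → allZero (p *P q)
allZero-*ˡ []      q z n = refl
allZero-*ˡ (a ∷ p) q z n
  rewrite coeff-+ (scaleP a q) (0ℚ ∷ (p *P q)) n | coeff-scale a q n | z 0 | ℚₚ.*-zeroˡ (coeff q n) with n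
... | zero  = refl
... | suc n = trans (ℚₚ.+-identityˡ _) (allZero-*ˡ p q (z ∘ suc) n)

allZero-*ʳ : ∀ p q → allZero q → allZero (p *P q)
allZero-*ʳ []      q z n = refl
allZero-*ʳ (a ∷ p) q z n
  rewrite coeff-+ (scaleP a q) (0ℚ ∷ (p *P q)) n | coeff-scale a q n | z n | ℚₚ.*-zeroʳ a with n
... | zero  = refl
... | suc n = trans (ℚₚ.+-identityˡ _) (allZero-*ʳ p q z n)

DegLe-* : DegLe p m → DegLe q n → DegLe (p *P q) (m ℕ.+ n)
DegLe-* {p} {m} {q} {n} dp dq = degLe (go p m dp)
  where
  go : ∀ p m → DegLe p m → ∀ k → m ℕ.+ n < k → coeff (p *P q) k ≡ 0ℚ
  go []      m       dp k _ = refl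
  go (a ∷ p) zero    dp k n<k
    rewrite coeff-+ (scaleP a q) (0ℚ ∷ (p *P q)) k | coeff-scale a q k | vanishes dq k n<k | ℚₚ.*-zeroʳ a with k
  ... | zero  = refl
  ... | suc k = trans (ℚₚ.+-identityˡ _) (allZero-*ˡ p q (DegLe0-tail dp) k)
  go (a ∷ p) (suc m) dp (suc k) (s≤s m+n<k)
    rewrite coeff-+ (scaleP a q) (0ℚ ∷ (p *P q)) (suc k) | coeff-scale a q (suc k)
          | vanishes dq (suc k) (s≤s (ℕₚ.≤-trans (ℕₚ.m≤n+m n m) (ℕₚ.<⇒≤ m+n<k))) | ℚₚ.*-zeroʳ a =
    trans (ℚₚ.+-identityˡ _) (go p m (DegLe-tail dp) k m+n<k)

coeff-*-top : DegLe p m → DegLe q n → coeff (p *P q) (m ℕ.+ n) ≡ coeff p m * coeff q n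
coeff-*-top {p} {m} {q} {n} dp dq = go p m n dp dq
  where
  go : ∀ p m n → DegLe p m → DegLe q n → coeff (p *P q) (m ℕ.+ n) ≡ coeff p m * coeff q n
  go []      m       n       dp dq = sym (ℚₚ.*-zeroˡ (coeff q n))
  go (a ∷ p) zero    zero    dp dq
    rewrite coeff-+ (scaleP a q) (0ℚ ∷ (p *P q)) 0 | coeff-scale a q 0 = ℚₚ.+-identityʳ _
  go (a ∷ p) zero    (suc n) dp dq
    rewrite coeff-+ (scaleP a q) (0ℚ ∷ (p *P q)) (suc n) | coeff-scale a q (suc n)
          | allZero-*ˡ p q (DegLe0-tail dp) n = ℚₚ.+-identityʳ _
  go (a ∷ p) (suc m) n       dp dq
    rewrite coeff-+ (scaleP a q) (0ℚ ∷ (p *P q)) (suc (m ℕ.+ n)) | coeff-scale a q (suc (m ℕ.+ n))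
          | vanishes dq (suc (m ℕ.+ n)) (s≤s (ℕₚ.m≤n+m n m)) | ℚₚ.*-zeroʳ a =
    trans (ℚₚ.+-identityˡ _) (go p m n (DegLe-tail dp) dq)

Deg-* : Deg p m → Deg q n → Deg (p *P q) (m ℕ.+ n)
Deg-* (lead≢0 , dp) (lead≢0′ , dq) =
  (λ e → *-≢0 lead≢0 lead≢0′ (trans (sym (coeff-*-top dp dq)) e)) , DegLe-* dp dq

allZero-comp : ∀ p q → allZero p → allZero (compP p q)
allZero-comp []      q z n = refl
allZero-comp (a ∷ p) q z n
  rewrite coeff-+ (constP a) (q *P compP p q) n | allZero-*ʳ q (compP p q) (allZero-comp p q (z ∘ suc)) n with n
... | zero  = trans (ℚₚ.+-identityʳ _) (z 0)
... | suc n = ℚₚ.+-identityʳ _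

DegLe-comp : DegLe p m → DegLe q n → DegLe (compP p q) (m ℕ.* n)
DegLe-comp {p} {m} {q} {n} dp dq = go p m dp
  where
  go : ∀ p m → DegLe p m → DegLe (compP p q) (m ℕ.* n)
  go []      m       dp = degLe λ _ _ → refl
  go (a ∷ p) zero    dp = degLe λ { (suc k) _ →
    trans (coeff-+ (constP a) (q *P compP p q) (suc k))
      (trans (cong (0ℚ +_) (allZero-*ʳ q (compP p q) (allZero-comp p q (DegLe0-tail dp)) (suc k))) (ℚₚ.+-identityʳ _)) }
  go (a ∷ p) (suc m) dp = degLe λ { (suc k) mn<k →
    trans (coeff-+ (constP a) (q *P compP p q) (suc k))
      (trans (cong (0ℚ +_) (vanishes (DegLe-* dq (go p m (DegLe-tail dp))) (suc k) mn<k)) (ℚₚ.+-identityʳ _)) }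

coeff-comp-top : DegLe p m → DegLe q (suc n) →
  coeff (compP p q) (m ℕ.* suc n) ≡ coeff p m * coeff q (suc n) ^ℚ m
coeff-comp-top {p} {m} {q} {n} dp dq = go p m dp
  where
  go : ∀ p m → DegLe p m → coeff (compP p q) (m ℕ.* suc n) ≡ coeff p m * coeff q (suc n) ^ℚ m
  go []      m       dp = sym (ℚₚ.*-zeroˡ (coeff q (suc n) ^ℚ m))
  go (a ∷ p) zero    dp
    rewrite coeff-+ (constP a) (q *P compP p q) 0
          | allZero-*ʳ q (compP p q) (allZero-comp p q (DegLe0-tail dp)) 0 =
    trans (ℚₚ.+-identityʳ _) (sym (ℚₚ.*-identityʳ a))
  go (a ∷ p) (suc m) dp
    rewrite coeff-+ (constP a) (q *P compP p q) (suc (n ℕ.+ m ℕ.* suc n))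
          | coeff-*-top dq (DegLe-comp (DegLe-tail dp) dq)
          | go p m (DegLe-tail dp) =
    trans (ℚₚ.+-identityˡ _)
      (solve 3 (λ l c P → l :* (c :* P) := c :* (l :* P)) refl (coeff q (suc n)) (coeff p m) (coeff q (suc n) ^ℚ m))

Deg-comp : Deg p m → Deg q (suc n) → Deg (compP p q) (m ℕ.* suc n)
Deg-comp {m = m} (lead≢0 , dp) (lead≢0′ , dq) =
  (λ e → *-≢0 lead≢0 (^ℚ-≢0 {n = m} lead≢0′) (trans (sym (coeff-comp-top dp dq)) e)) , DegLe-comp dp dq

DegLe-^ : ∀ n → DegLe p m → DegLe (p ^P n) (n ℕ.* m)
DegLe-^ zero    d = DegLe-const 1ℚ
DegLe-^ (suc n) d = DegLe-* d (DegLe-^ n d)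

Deg-X^ : ∀ n → Deg (X ^P n) n
Deg-X^ zero    = Deg-const (λ ())
Deg-X^ (suc n) = Deg-* Deg-X (Deg-X^ n)

DegLe0-evalP : ∀ p x → DegLe p 0 → evalP p x ≡ coeff p 0
DegLe0-evalP []      x d = refl
DegLe0-evalP (a ∷ p) x d rewrite evalP-allZero p x (DegLe0-tail d) =
  trans (cong (a +_) (ℚₚ.*-zeroʳ x)) (ℚₚ.+-identityʳ a)

Root : Poly → ℚ → Set
Root p r = evalP p r ≡ 0ℚ

divLin : ℚ → Poly → Poly
divLin c []      = []
divLin c (a ∷ p) = evalP p c ∷ divLin c p

evalP-divLin : ∀ c p y → evalP p y ≡ (y - c) * evalP (divLin c p) y + evalP p c
evalP-divLin c []      y = solve 2 (λ c y → con 0ℚ := (y :- c) :* con 0ℚ :+ con 0ℚ) refl c y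
evalP-divLin c (a ∷ p) y rewrite evalP-divLin c p y =
  solve 5 (λ a y c Q E → a :+ y :* ((y :- c) :* Q :+ E) := (y :- c) :* (E :+ y :* Q) :+ (a :+ c :* E)) refl
    a y c (evalP (divLin c p) y) (evalP p c)

factor-theorem : ∀ {p c} → Root p c → ∀ y → evalP p y ≡ (y - c) * evalP (divLin c p) y
factor-theorem {p} {c} pc≡0 y =
  trans (evalP-divLin c p y) (trans (cong ((y - c) * evalP (divLin c p) y +_) pc≡0) (ℚₚ.+-identityʳ _))

allZero-divLin : ∀ c p → DegLe p 0 → allZero (divLin c p)
allZero-divLin c []      d m       = refl
allZero-divLin c (a ∷ p) d zero    = evalP-allZero p c (DegLe0-tail d)
allZero-divLin c (a ∷ p) d (suc m) = allZero-divLin c p (degLe λ k _ → DegLe0-tail d k) m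

DegLe-divLin : ∀ c p → DegLe p (suc n) → DegLe (divLin c p) n
DegLe-divLin c []      d = degLe λ _ _ → refl
DegLe-divLin {zero}  c (a ∷ p) d = degLe λ { (suc m) _ → allZero-divLin c p (DegLe-tail d) m }
DegLe-divLin {suc n} c (a ∷ p) d =
  degLe λ { (suc m) (s≤s n<m) → vanishes (DegLe-divLin c p (DegLe-tail d)) m n<m }

allZero-of-divLin : ∀ c p → Root p c → allZero (divLin c p) → allZero p
allZero-of-divLin c []      _    _ n       = refl
allZero-of-divLin c (a ∷ p) pc≡0 z zero    = begin
  a                ≡⟨ solve 2 (λ a c → a := a :+ c :* con 0ℚ) refl a c ⟩
  a + c * 0ℚ       ≡⟨ cong (λ v → a + c * v) (sym (z 0)) ⟩
  evalP (a ∷ p) c  ≡⟨ pc≡0 ⟩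
  0ℚ               ∎
  where open ≡-Reasoning
allZero-of-divLin c (a ∷ p) _    z (suc n) = allZero-of-divLin c p (z 0) (z ∘ suc) n

allZero-of-roots : ∀ {p n} rs → DegLe p n → Unique rs → n < length rs → All (Root p) rs → allZero p
allZero-of-roots {p} {zero}  (r ∷ rs) d _ _ (pr ∷ _) =
  allZero-of-divLin r p pr (allZero-divLin r p d)
allZero-of-roots {p} {suc n} (r ∷ rs) d (r∉rs ∷ u) (s≤s n<l) (pr ∷ prs) =
  allZero-of-divLin r p pr (allZero-of-roots rs (DegLe-divLin r p d) u n<l (quotient-roots rs r∉rs prs))
  where
  quotient-roots : ∀ ys → All (r ≢_) ys → All (Root p) ys → All (Root (divLin r p)) ys
  quotient-roots []       []            []          = []
  quotient-roots (y ∷ ys) (r≢y ∷ r∉ys) (py ∷ pys) =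
    x*y≡0⇒y≡0 (trans (sym (factor-theorem {p} pr y)) py) (λ y-r≡0 → r≢y (sym (x-y≡0⇒x≡y y-r≡0)))
      ∷ quotient-roots ys r∉ys pys

length-roots≤ : ∀ {p n} rs → ¬ allZero p → DegLe p n → Unique rs → All (Root p) rs → length rs ≤ n
length-roots≤ {n = n} rs p≢0 d u prs with length rs ℕₚ.≤? n
... | yes l≤n = l≤n
... | no l≰n  = ⊥-elim (p≢0 (allZero-of-roots rs d u (ℕₚ.≰⇒> l≰n) prs))

DegLe-sub : DegLe p n → DegLe q n → DegLe (p -P q) n
DegLe-sub dp dq = DegLe-+ dp (DegLe-scale (- 1ℚ) dq)

DegLe-sub-top : DegLe p (suc n) → DegLe q (suc n) → coeff p (suc n) ≡ coeff q (suc n) → DegLe (p -P q) n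
DegLe-sub-top {p} {n} {q} dp dq top≡ = degLe beyond
  where
  beyond : ∀ m → n < m → coeff (p -P q) m ≡ 0ℚ
  beyond m n<m with ℕₚ.m≤n⇒m<n∨m≡n n<m
  ... | inj₁ n+1<m = vanishes (DegLe-sub dp dq) m n+1<m
  ... | inj₂ refl  = trans (coeff-sub p q m) (trans (cong (_- coeff q m) top≡) (ℚₚ.+-inverseʳ (coeff q m)))

≈-of-agreement : ∀ {p q n} rs → DegLe (p -P q) n → Unique rs → n < length rs →
  All (λ r → evalP p r ≡ evalP q r) rs → p ≈P q
≈-of-agreement {p} {q} rs d u n<l agree = allZero-sub⇒≈ {p} {q} (allZero-of-roots rs d u n<l (All.map root agree))
  where
  root : ∀ {r} → evalP p r ≡ evalP q r → Root (p -P q) r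
  root {r} e = trans (evalP-sub p q r) (trans (cong (_- evalP q r) e) (ℚₚ.+-inverseʳ (evalP q r)))

evalP-injective : (∀ y → evalP p y ≡ evalP q y) → p ≈P q
evalP-injective {p} {q} agree =
  ≈-of-agreement {p} {q} points (degLe λ m l<m → coeff≥length (p -P q) (ℕₚ.<⇒≤ l<m))
    (Uniqueₚ.tabulate⁺ {f = fromℕ ∘ toℕ} (Finₚ.toℕ-injective ∘ fromℕ-injective))
    (ℕₚ.≤-reflexive (sym (Listₚ.length-tabulate (fromℕ ∘ toℕ))))
    (Allₚ.tabulate⁺ {f = fromℕ ∘ toℕ} (λ i → agree (fromℕ (toℕ i))))
  where
  points : List ℚ
  points = tabulate {n = suc (length (p -P q))} (fromℕ ∘ toℕ)

deriv : Poly → Poly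
deriv []      = []
deriv (a ∷ p) = p +P (0ℚ ∷ deriv p)

evalP-deriv-∷ : ∀ a p x → evalP (deriv (a ∷ p)) x ≡ evalP p x + x * evalP (deriv p) x
evalP-deriv-∷ a p x = trans (evalP-+ p (0ℚ ∷ deriv p) x) (cong (evalP p x +_) (ℚₚ.+-identityˡ _))

evalP-deriv-+ : ∀ p q x → evalP (deriv (p +P q)) x ≡ evalP (deriv p) x + evalP (deriv q) x
evalP-deriv-+ []      q       x = sym (ℚₚ.+-identityˡ _)
evalP-deriv-+ (a ∷ p) []      x = sym (ℚₚ.+-identityʳ _)
evalP-deriv-+ (a ∷ p) (b ∷ q) x
  rewrite evalP-deriv-∷ (a + b) (p +P q) x | evalP-deriv-∷ a p x | evalP-deriv-∷ b q x
        | evalP-+ p q x | evalP-deriv-+ p q x =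
  solve 5 (λ x P Q P′ Q′ → (P :+ Q) :+ x :* (P′ :+ Q′) := (P :+ x :* P′) :+ (Q :+ x :* Q′)) refl
    x (evalP p x) (evalP q x) (evalP (deriv p) x) (evalP (deriv q) x)

evalP-deriv-scale : ∀ c p x → evalP (deriv (scaleP c p)) x ≡ c * evalP (deriv p) x
evalP-deriv-scale c []      x = sym (ℚₚ.*-zeroʳ c)
evalP-deriv-scale c (a ∷ p) x
  rewrite evalP-deriv-∷ (c * a) (scaleP c p) x | evalP-deriv-∷ a p x
        | evalP-scale c p x | evalP-deriv-scale c p x =
  solve 4 (λ c x P P′ → c :* P :+ x :* (c :* P′) := c :* (P :+ x :* P′)) refl c x (evalP p x) (evalP (deriv p) x)

evalP-deriv-* : ∀ p q x → evalP (deriv (p *P q)) x ≡ evalP (deriv p) x * evalP q x + evalP p x * evalP (deriv q) x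
evalP-deriv-* []      q x = solve 2 (λ Q Q′ → con 0ℚ := con 0ℚ :* Q :+ con 0ℚ :* Q′) refl (evalP q x) (evalP (deriv q) x)
evalP-deriv-* (a ∷ p) q x
  rewrite evalP-deriv-+ (scaleP a q) (0ℚ ∷ (p *P q)) x | evalP-deriv-scale a q x
        | evalP-deriv-∷ 0ℚ (p *P q) x | evalP-deriv-∷ a p x | evalP-* p q x | evalP-deriv-* p q x =
  solve 6 (λ a x P P′ Q Q′ → a :* Q′ :+ (P :* Q :+ x :* (P′ :* Q :+ P :* Q′))
                          := (P :+ x :* P′) :* Q :+ (a :+ x :* P) :* Q′) refl
    a x (evalP p x) (evalP (deriv p) x) (evalP q x) (evalP (deriv q) x)

evalP-deriv-const : ∀ c x → evalP (deriv (constP c)) x ≡ 0ℚ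
evalP-deriv-const c x = solve 1 (λ x → con 0ℚ :+ x :* con 0ℚ := con 0ℚ) refl x

evalP-deriv-X : ∀ x → evalP (deriv X) x ≡ 1ℚ
evalP-deriv-X x = solve 1 (λ x → (con 1ℚ :+ con 0ℚ) :+ x :* (con 0ℚ :+ x :* con 0ℚ) := con 1ℚ) refl x

deriv-allZero : ∀ p → allZero p → allZero (deriv p)
deriv-allZero []      z n = refl
deriv-allZero (a ∷ p) z n = trans (coeff-+ p (0ℚ ∷ deriv p) n)
  (trans (cong₂ _+_ (z (suc n)) (shifted n)) (ℚₚ.+-identityˡ 0ℚ))
  where
  shifted : ∀ n → coeff (0ℚ ∷ deriv p) n ≡ 0ℚ
  shifted zero    = refl
  shifted (suc n) = deriv-allZero p (z ∘ suc) n

deriv-cong : ∀ {p q} → p ≈P q → deriv p ≈P deriv q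
deriv-cong {[]}    {q}     e n = sym (deriv-allZero q (sym ∘ e) n)
deriv-cong {a ∷ p} {[]}    e n = deriv-allZero (a ∷ p) e n
deriv-cong {a ∷ p} {b ∷ q} e n = trans (coeff-+ p (0ℚ ∷ deriv p) n)
  (trans (cong₂ _+_ (e (suc n)) (shifted n)) (sym (coeff-+ q (0ℚ ∷ deriv q) n)))
  where
  shifted : ∀ n → coeff (0ℚ ∷ deriv p) n ≡ coeff (0ℚ ∷ deriv q) n
  shifted zero    = refl
  shifted (suc n) = deriv-cong {p} {q} (e ∘ suc) n

DegLe-deriv : ∀ p → DegLe p n → DegLe (deriv p) n
DegLe-deriv []      d = degLe λ _ _ → refl
DegLe-deriv {n} (a ∷ p) d = degLe λ m n<m → trans (coeff-+ p (0ℚ ∷ deriv p) m)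
  (trans (cong₂ _+_ (vanishes d (suc m) (ℕₚ.m<n⇒m<1+n n<m)) (shifted n d m n<m)) (ℚₚ.+-identityˡ 0ℚ))
  where
  shifted : ∀ n → DegLe (a ∷ p) n → ∀ m → n < m → coeff (0ℚ ∷ deriv p) m ≡ 0ℚ
  shifted zero    d (suc m) _         = deriv-allZero p (DegLe0-tail d) m
  shifted (suc n) d (suc m) (s≤s n<m) = vanishes (DegLe-deriv p (DegLe-tail d)) m n<m

-- Products of linear factors and Lagrange interpolation

linP : ℚ → Poly
linP r = X +P constP (- r)

prodL : List ℚ → Poly
prodL []       = constP 1ℚ
prodL (r ∷ rs) = linP r *P prodL rs

evalP-linP : ∀ r y → evalP (linP r) y ≡ y - r
evalP-linP r y = solve 2 (λ r y → (con 0ℚ :+ :- r) :+ y :* (con 1ℚ :+ y :* con 0ℚ) := y :- r) refl r y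

evalP-prodL-∷ : ∀ r rs y → evalP (prodL (r ∷ rs)) y ≡ (y - r) * evalP (prodL rs) y
evalP-prodL-∷ r rs y = trans (evalP-* (linP r) (prodL rs) y) (cong (_* evalP (prodL rs) y) (evalP-linP r y))

DegLe-linP : ∀ r → DegLe (linP r) 1
DegLe-linP r = DegLe-+ DegLe-X (DegLe-mono z≤n (DegLe-const (- r)))

DegLe-prodL : ∀ rs → DegLe (prodL rs) (length rs)
DegLe-prodL []       = DegLe-const 1ℚ
DegLe-prodL (r ∷ rs) = DegLe-* (DegLe-linP r) (DegLe-prodL rs)

coeff-prodL-top : ∀ rs → coeff (prodL rs) (length rs) ≡ 1ℚ
coeff-prodL-top []       = refl
coeff-prodL-top (r ∷ rs)
  rewrite coeff-*-top (DegLe-linP r) (DegLe-prodL rs) | coeff-prodL-top rs = refl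

Deg-prodL : ∀ rs → Deg (prodL rs) (length rs)
Deg-prodL rs = (λ e → ℚₚ.1≢0 (trans (sym (coeff-prodL-top rs)) e)) , DegLe-prodL rs

prodL-root : y ∈ rs → Root (prodL rs) y
prodL-root {y} {r ∷ rs} (here refl) =
  trans (evalP-prodL-∷ y rs y) (trans (cong (_* evalP (prodL rs) y) (ℚₚ.+-inverseʳ y)) (ℚₚ.*-zeroˡ (evalP (prodL rs) y)))
prodL-root {y} {r ∷ rs} (there y∈rs) =
  trans (evalP-prodL-∷ r rs y) (trans (cong ((y - r) *_) (prodL-root {rs = rs} y∈rs)) (ℚₚ.*-zeroʳ (y - r)))

prodL-≢0 : y ∉ rs → evalP (prodL rs) y ≢ 0ℚ
prodL-≢0 {y} {[]}     _    e = ℚₚ.1≢0 (trans (sym (evalP-const 1ℚ y)) e)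
prodL-≢0 {y} {r ∷ rs} y∉rs e = *-≢0 y-r≢0 (prodL-≢0 {rs = rs} (y∉rs ∘ there)) (trans (sym (evalP-prodL-∷ r rs y)) e)
  where
  y-r≢0 : y - r ≢ 0ℚ
  y-r≢0 y-r≡0 = y∉rs (here (x-y≡0⇒x≡y y-r≡0))

evalP-prodL-↭ : ∀ {rs ts} y → rs ↭ ts → evalP (prodL rs) y ≡ evalP (prodL ts) y
evalP-prodL-↭ y ↭.refl          = refl
evalP-prodL-↭ y (↭.prep {xs} {ys} r σ) =
  trans (evalP-prodL-∷ r xs y) (trans (cong ((y - r) *_) (evalP-prodL-↭ y σ)) (sym (evalP-prodL-∷ r ys y)))
evalP-prodL-↭ y (↭.swap {xs} {ys} r u σ) = begin
  evalP (prodL (r ∷ u ∷ xs)) y                ≡⟨ evalP-prodL-∷ r (u ∷ xs) y ⟩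
  (y - r) * evalP (prodL (u ∷ xs)) y          ≡⟨ cong ((y - r) *_) (evalP-prodL-∷ u xs y) ⟩
  (y - r) * ((y - u) * evalP (prodL xs) y)    ≡⟨ cong (λ v → (y - r) * ((y - u) * v)) (evalP-prodL-↭ y σ) ⟩
  (y - r) * ((y - u) * evalP (prodL ys) y)    ≡⟨ solve 3 (λ a b v → a :* (b :* v) := b :* (a :* v)) refl
                                                   (y - r) (y - u) (evalP (prodL ys) y) ⟩
  (y - u) * ((y - r) * evalP (prodL ys) y)    ≡⟨ sym (cong ((y - u) *_) (evalP-prodL-∷ r ys y)) ⟩
  (y - u) * evalP (prodL (r ∷ ys)) y          ≡⟨ sym (evalP-prodL-∷ u (r ∷ ys) y) ⟩
  evalP (prodL (u ∷ r ∷ ys)) y                ∎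
  where open ≡-Reasoning
evalP-prodL-↭ y (↭.trans σ τ)   = trans (evalP-prodL-↭ y σ) (evalP-prodL-↭ y τ)

sumℚ : {A : Set} → (A → ℚ) → List A → ℚ
sumℚ f []       = 0ℚ
sumℚ f (x ∷ xs) = f x + sumℚ f xs

module _ {A : Set} where

  sumℚ-map : ∀ {B : Set} (f : A → ℚ) (h : B → A) xs → sumℚ f (map h xs) ≡ sumℚ (f ∘ h) xs
  sumℚ-map f h []       = refl
  sumℚ-map f h (x ∷ xs) = cong (f (h x) +_) (sumℚ-map f h xs)

  sumℚ-cong : ∀ {f g : A → ℚ} xs → (∀ {x} → x ∈ xs → f x ≡ g x) → sumℚ f xs ≡ sumℚ g xs
  sumℚ-cong []       _   = refl
  sumℚ-cong (x ∷ xs) f≗g = cong₂ _+_ (f≗g (here refl)) (sumℚ-cong xs (f≗g ∘ there))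

  sumℚ-zero : ∀ {f : A → ℚ} xs → (∀ {x} → x ∈ xs → f x ≡ 0ℚ) → sumℚ f xs ≡ 0ℚ
  sumℚ-zero []       _  = refl
  sumℚ-zero (x ∷ xs) f0 =
    trans (cong₂ _+_ (f0 (here refl)) (sumℚ-zero xs (f0 ∘ there))) (ℚₚ.+-identityˡ 0ℚ)

  sumℚ-*ˡ : ∀ c (f : A → ℚ) xs → sumℚ (λ x → c * f x) xs ≡ c * sumℚ f xs
  sumℚ-*ˡ c f []       = sym (ℚₚ.*-zeroʳ c)
  sumℚ-*ˡ c f (x ∷ xs) = trans (cong (c * f x +_) (sumℚ-*ˡ c f xs)) (sym (ℚₚ.*-distribˡ-+ c (f x) _))

  sumℚ-pos : ∀ {f : A → ℚ} x xs → (∀ {u} → u ∈ x ∷ xs → 0ℚ ℚ.< f u) → 0ℚ ℚ.< sumℚ f (x ∷ xs)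
  sumℚ-pos {f} x xs f>0 = subst (ℚ._< f x + sumℚ f xs) (ℚₚ.+-identityʳ 0ℚ)
    (ℚₚ.+-mono-<-≤ (f>0 (here refl)) (nonneg xs (f>0 ∘ there)))
    where
    nonneg : ∀ {f : A → ℚ} xs → (∀ {u} → u ∈ xs → 0ℚ ℚ.< f u) → 0ℚ ℚ.≤ sumℚ f xs
    nonneg []       _   = ℚₚ.≤-refl
    nonneg (x ∷ xs) f>0 = ℚₚ.<⇒≤ (sumℚ-pos x xs f>0)

  sumP : (A → Poly) → List A → Poly
  sumP f []       = []
  sumP f (x ∷ xs) = f x +P sumP f xs

  evalP-sumP : ∀ (f : A → Poly) xs y → evalP (sumP f xs) y ≡ sumℚ (λ x → evalP (f x) y) xs
  evalP-sumP f []       y = refl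
  evalP-sumP f (x ∷ xs) y = trans (evalP-+ (f x) (sumP f xs) y) (cong (evalP (f x) y +_) (evalP-sumP f xs y))

  coeff-sumP : ∀ (f : A → Poly) xs n → coeff (sumP f xs) n ≡ sumℚ (λ x → coeff (f x) n) xs
  coeff-sumP f []       n = refl
  coeff-sumP f (x ∷ xs) n = trans (coeff-+ (f x) (sumP f xs) n) (cong (coeff (f x) n +_) (coeff-sumP f xs n))

  DegLe-sumP : ∀ {f : A → Poly} xs → (∀ {x} → x ∈ xs → DegLe (f x) n) → DegLe (sumP f xs) n
  DegLe-sumP []       _ = degLe λ _ _ → refl
  DegLe-sumP (x ∷ xs) d = DegLe-+ (d (here refl)) (DegLe-sumP xs (d ∘ there))

picks : List ℚ → List (ℚ × List ℚ)
picks []       = []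
picks (r ∷ rs) = (r , rs) ∷ map (map₂ (r ∷_)) (picks rs)

∈-picks-shift : (s , t) ∈ picks rs → ∀ r → (s , r ∷ t) ∈ picks (r ∷ rs)
∈-picks-shift st∈ r = there (∈-map⁺ (map₂ (r ∷_)) st∈)

picks-↭ : (s , t) ∈ picks rs → s ∷ t ↭ rs
picks-↭ {rs = r ∷ rs} (here refl)    = ↭.refl
picks-↭ {rs = r ∷ rs} (there st∈) with ∈-map⁻ (map₂ (r ∷_)) st∈
... | (s , t) , st∈′ , refl = ↭.trans (↭.swap s r ↭.refl) (↭.prep r (picks-↭ st∈′))

picks-∉ : Unique rs → (s , t) ∈ picks rs → s ∉ t
picks-∉ u st∈ with ↭ₛ.Unique-resp-↭ (setoid ℚ) (↭⇒↭ₛ (↭-sym (picks-↭ st∈))) u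
... | s∉t ∷ _ = λ s∈t → All.lookup s∉t s∈t refl

picks-length : (s , t) ∈ picks rs → suc (length t) ≡ length rs
picks-length st∈ = ↭-length (picks-↭ st∈)

sumℚ-picks-at : ∀ {g : ℚ × List ℚ → ℚ} {v} rs → y ∈ rs →
  (∀ {s t} → (s , t) ∈ picks rs → y ∈ t → g (s , t) ≡ 0ℚ) →
  (∀ {t} → (y , t) ∈ picks rs → g (y , t) ≡ v) →
  sumℚ g (picks rs) ≡ v
sumℚ-picks-at {y} {g} {v} (r ∷ rs) (here refl) vanish pick-y = begin
  g (y , rs) + sumℚ g (map (map₂ (y ∷_)) (picks rs))
    ≡⟨ cong₂ _+_ (pick-y (here refl)) (sumℚ-map g _ (picks rs)) ⟩
  v + sumℚ (g ∘ map₂ (y ∷_)) (picks rs)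
    ≡⟨ cong (v +_) (sumℚ-zero (picks rs) (λ st∈ → vanish (∈-picks-shift st∈ y) (here refl))) ⟩
  v + 0ℚ
    ≡⟨ ℚₚ.+-identityʳ v ⟩
  v ∎
  where open ≡-Reasoning
sumℚ-picks-at {y} {g} {v} (r ∷ rs) (there y∈rs) vanish pick-y = begin
  g (r , rs) + sumℚ g (map (map₂ (r ∷_)) (picks rs))
    ≡⟨ cong₂ _+_ (vanish (here refl) y∈rs) (sumℚ-map g _ (picks rs)) ⟩
  0ℚ + sumℚ (g ∘ map₂ (r ∷_)) (picks rs)
    ≡⟨ ℚₚ.+-identityˡ _ ⟩
  sumℚ (g ∘ map₂ (r ∷_)) (picks rs)
    ≡⟨ sumℚ-picks-at rs y∈rs (λ st∈ y∈t → vanish (∈-picks-shift st∈ r) (there y∈t))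
                             (λ yt∈ → pick-y (∈-picks-shift yt∈ r)) ⟩
  v ∎
  where open ≡-Reasoning

nodeWeight : ℚ × List ℚ → ℚ
nodeWeight (s , t) = evalP (prodL t) s

lagrangeWeight : Poly → ℚ × List ℚ → ℚ
lagrangeWeight P (s , t) = evalP P s * inv (nodeWeight (s , t))

-- The interpolant Σ lagrangeWeight P (s , t) · ∏_{u ∈ t} (x - u) agrees with P at the length rs nodes,
-- so it is P; its coefficient of x^(m+1) is the sum.
lagrange-sum : ∀ {P m} rs → Unique rs → length rs ≡ suc (suc m) → DegLe P m →
  sumℚ (lagrangeWeight P) (picks rs) ≡ 0ℚ
lagrange-sum {P} {m} rs u len dP = begin
  sumℚ (lagrangeWeight P) (picks rs)                ≡⟨ sumℚ-cong (picks rs) (λ st∈ → sym (top-coeff st∈)) ⟩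
  sumℚ (λ st → coeff (term st) (suc m)) (picks rs)  ≡⟨ sym (coeff-sumP term (picks rs) (suc m)) ⟩
  coeff L (suc m)                                    ≡⟨ L≈P (suc m) ⟩
  coeff P (suc m)                                    ≡⟨ vanishes dP (suc m) ℕₚ.≤-refl ⟩
  0ℚ                                                 ∎
  where
  open ≡-Reasoning
  term : ℚ × List ℚ → Poly
  term st = scaleP (lagrangeWeight P st) (prodL (proj₂ st))
  L : Poly
  L = sumP term (picks rs)
  length-t : (s , t) ∈ picks rs → length t ≡ suc m
  length-t st∈ = ℕₚ.suc-injective (trans (picks-length st∈) len)
  top-coeff : ∀ {st} → st ∈ picks rs → coeff (term st) (suc m) ≡ lagrangeWeight P st
  top-coeff {s , t} st∈ = trans (coeff-scale (lagrangeWeight P (s , t)) (prodL t) (suc m))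
    (trans (cong (lagrangeWeight P (s , t) *_) (subst (λ l → coeff (prodL t) l ≡ 1ℚ) (length-t st∈) (coeff-prodL-top t)))
      (ℚₚ.*-identityʳ _))
  DegLe-L : DegLe L (suc m)
  DegLe-L = DegLe-sumP (picks rs) λ { {s , t} st∈ →
    DegLe-scale (lagrangeWeight P (s , t)) (subst (DegLe (prodL t)) (length-t st∈) (DegLe-prodL t)) }
  interpolates : ∀ {y} → y ∈ rs → evalP L y ≡ evalP P y
  interpolates {y} y∈rs = trans (evalP-sumP term (picks rs) y) (sumℚ-picks-at rs y∈rs vanish at-y)
    where
    vanish : ∀ {s t} → (s , t) ∈ picks rs → y ∈ t → evalP (term (s , t)) y ≡ 0ℚ
    vanish {s} {t} _ y∈t = trans (evalP-scale (lagrangeWeight P (s , t)) (prodL t) y)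
      (trans (cong (lagrangeWeight P (s , t) *_) (prodL-root y∈t)) (ℚₚ.*-zeroʳ (lagrangeWeight P (s , t))))
    at-y : ∀ {t} → (y , t) ∈ picks rs → evalP (term (y , t)) y ≡ evalP P y
    at-y {t} yt∈ = begin
      evalP (term (y , t)) y   ≡⟨ evalP-scale (lagrangeWeight P (y , t)) (prodL t) y ⟩
      evalP P y * inv w * w    ≡⟨ ℚₚ.*-assoc (evalP P y) (inv w) w ⟩
      evalP P y * (inv w * w)  ≡⟨ cong (evalP P y *_) (inv-inverseˡ (prodL-≢0 (picks-∉ u yt∈))) ⟩
      evalP P y * 1ℚ           ≡⟨ ℚₚ.*-identityʳ _ ⟩
      evalP P y                ∎
      where w = evalP (prodL t) y
  L≈P : L ≈P P
  L≈P = ≈-of-agreement {L} {P} rs (DegLe-sub DegLe-L (DegLe-mono (ℕₚ.n≤1+n m) dP)) u (ℕₚ.≤-reflexive (sym len))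
    (All.tabulate interpolates)

evalP-deriv-linP : ∀ r y → evalP (deriv (linP r)) y ≡ 1ℚ
evalP-deriv-linP r y = trans (evalP-deriv-+ X (constP (- r)) y)
  (trans (cong₂ _+_ (evalP-deriv-X y) (evalP-deriv-const (- r) y)) (ℚₚ.+-identityʳ 1ℚ))

evalP-deriv-prodL-pick : (s , t) ∈ picks rs → evalP (deriv (prodL rs)) s ≡ nodeWeight (s , t)
evalP-deriv-prodL-pick {s} {t} {rs} st∈ = begin
  evalP (deriv (prodL rs)) s
    ≡⟨ evalP-cong {deriv (prodL rs)} {deriv (prodL (s ∷ t))} s (deriv-cong {prodL rs} {prodL (s ∷ t)} prodL≈) ⟩
  evalP (deriv (linP s *P prodL t)) s
    ≡⟨ evalP-deriv-* (linP s) (prodL t) s ⟩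
  evalP (deriv (linP s)) s * W + evalP (linP s) s * W′
    ≡⟨ cong₂ (λ u v → u * W + v * W′) (evalP-deriv-linP s s) (trans (evalP-linP s s) (ℚₚ.+-inverseʳ s)) ⟩
  1ℚ * W + 0ℚ * W′
    ≡⟨ solve 2 (λ W W′ → con 1ℚ :* W :+ con 0ℚ :* W′ := W) refl W W′ ⟩
  W ∎
  where
  open ≡-Reasoning
  W  = evalP (prodL t) s
  W′ = evalP (deriv (prodL t)) s
  prodL≈ : prodL rs ≈P prodL (s ∷ t)
  prodL≈ = evalP-injective {prodL rs} {prodL (s ∷ t)} λ y → evalP-prodL-↭ y (↭-sym (picks-↭ st∈))

fibre-factorisation : ∀ {H c n} rs → Deg H (suc n) → Unique rs → length rs ≡ suc n →
  All (λ r → evalP H r ≡ c) rs → H ≈P constP c +P scaleP (coeff H (suc n)) (prodL rs)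
fibre-factorisation {H} {c} {n} rs (_ , dH) u len fibre =
  ≈-of-agreement {H} {K} rs (DegLe-sub-top dH dK top) u (ℕₚ.≤-reflexive (sym len))
    (All.tabulate λ r∈rs → trans (All.lookup fibre r∈rs) (sym (evalP-K r∈rs)))
  where
  ℓ = coeff H (suc n)
  K = constP c +P scaleP ℓ (prodL rs)
  dK : DegLe K (suc n)
  dK = DegLe-+ (DegLe-mono z≤n (DegLe-const c)) (DegLe-scale ℓ (subst (DegLe (prodL rs)) len (DegLe-prodL rs)))
  top : coeff H (suc n) ≡ coeff K (suc n)
  top = sym (begin
    coeff K (suc n)                              ≡⟨ coeff-+ (constP c) (scaleP ℓ (prodL rs)) (suc n) ⟩
    0ℚ + coeff (scaleP ℓ (prodL rs)) (suc n)     ≡⟨ cong (0ℚ +_) (coeff-scale ℓ (prodL rs) (suc n)) ⟩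
    0ℚ + ℓ * coeff (prodL rs) (suc n)            ≡⟨ cong (λ v → 0ℚ + ℓ * v)
                                                      (subst (λ l → coeff (prodL rs) l ≡ 1ℚ) len (coeff-prodL-top rs)) ⟩
    0ℚ + ℓ * 1ℚ                                  ≡⟨ solve 1 (λ l → con 0ℚ :+ l :* con 1ℚ := l) refl ℓ ⟩
    ℓ                                            ∎)
    where open ≡-Reasoning
  evalP-K : ∀ {r} → r ∈ rs → evalP K r ≡ c
  evalP-K {r} r∈rs = begin
    evalP K r                                          ≡⟨ evalP-+ (constP c) (scaleP ℓ (prodL rs)) r ⟩
    evalP (constP c) r + evalP (scaleP ℓ (prodL rs)) r ≡⟨ cong₂ _+_ (evalP-const c r) (evalP-scale ℓ (prodL rs) r) ⟩
    c + ℓ * evalP (prodL rs) r                         ≡⟨ cong (λ v → c + ℓ * v) (prodL-root r∈rs) ⟩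
    c + ℓ * 0ℚ                                         ≡⟨ solve 2 (λ c l → c :+ l :* con 0ℚ := c) refl c ℓ ⟩
    c                                                  ∎
    where open ≡-Reasoning

evalP-deriv-fibre : ∀ {H c n} rs → Deg H (suc n) → Unique rs → length rs ≡ suc n →
  All (λ r → evalP H r ≡ c) rs → ∀ y → evalP (deriv H) y ≡ coeff H (suc n) * evalP (deriv (prodL rs)) y
evalP-deriv-fibre {H} {c} {n} rs dH u len fibre y = begin
  evalP (deriv H) y                                   ≡⟨ evalP-cong {deriv H} {deriv K} y (deriv-cong {H} {K} H≈K) ⟩
  evalP (deriv K) y                                   ≡⟨ evalP-deriv-+ (constP c) (scaleP ℓ (prodL rs)) y ⟩
  evalP (deriv (constP c)) y + evalP (deriv (scaleP ℓ (prodL rs))) y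
    ≡⟨ cong₂ _+_ (evalP-deriv-const c y) (evalP-deriv-scale ℓ (prodL rs) y) ⟩
  0ℚ + ℓ * evalP (deriv (prodL rs)) y                 ≡⟨ ℚₚ.+-identityˡ _ ⟩
  ℓ * evalP (deriv (prodL rs)) y                      ∎
  where
  open ≡-Reasoning
  ℓ = coeff H (suc n)
  K = constP c +P scaleP ℓ (prodL rs)
  H≈K = fibre-factorisation rs dH u len fibre

no-full-fibre : ∀ {H S P c m} rs → Deg H (suc (suc m)) → DegLe P m →
  (∀ y → evalP (deriv H) y ≡ evalP S y * evalP S y * evalP P y) →
  Unique rs → length rs ≡ suc (suc m) → All (λ r → evalP H r ≡ c) rs → ⊥
no-full-fibre {H} {S} {P} {c} {m} rs@(r₀ ∷ rs₀) dH@(ℓ≢0 , _) dP H′≡S²P u len fibre =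
  ℚₚ.<-irrefl (sym sum≡0) sum>0
  where
  ℓ = coeff H (suc (suc m))
  g = lagrangeWeight P
  -- S(s)² P(s) = H′(s) = ℓ w at each node s, so ℓ P(s) / w has the sign of ℓ²
  term-pos : ∀ {st} → st ∈ picks rs → 0ℚ ℚ.< ℓ * g st
  term-pos {s , t} st∈ = pos-of-*-nonneg (square-nonneg σ) (subst (0ℚ ℚ.<_) (sym key) (square-pos ℓ≢0))
    where
    open ≡-Reasoning
    w = nodeWeight (s , t)
    σ = evalP S s
    S²P≡ℓw : σ * σ * evalP P s ≡ ℓ * w
    S²P≡ℓw = trans (sym (H′≡S²P s))
      (trans (evalP-deriv-fibre rs dH u len fibre s) (cong (ℓ *_) (evalP-deriv-prodL-pick st∈)))
    key : ℓ * g (s , t) * (σ * σ) ≡ ℓ * ℓ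
    key = begin
      ℓ * (evalP P s * inv w) * (σ * σ) ≡⟨ solve 4 (λ l p i σ → l :* (p :* i) :* (σ :* σ) := l :* i :* (σ :* σ :* p))
                                             refl ℓ (evalP P s) (inv w) σ ⟩
      ℓ * inv w * (σ * σ * evalP P s)   ≡⟨ cong (ℓ * inv w *_) S²P≡ℓw ⟩
      ℓ * inv w * (ℓ * w)               ≡⟨ solve 3 (λ l i w → l :* i :* (l :* w) := l :* l :* (i :* w))
                                             refl ℓ (inv w) w ⟩
      ℓ * ℓ * (inv w * w)               ≡⟨ cong (ℓ * ℓ *_) (inv-inverseˡ (prodL-≢0 (picks-∉ u st∈))) ⟩
      ℓ * ℓ * 1ℚ                        ≡⟨ ℚₚ.*-identityʳ _ ⟩
      ℓ * ℓ                             ∎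
  sum>0 : 0ℚ ℚ.< sumℚ (λ st → ℓ * g st) (picks rs)
  sum>0 = sumℚ-pos (r₀ , rs₀) _ term-pos
  sum≡0 : sumℚ (λ st → ℓ * g st) (picks rs) ≡ 0ℚ
  sum≡0 = trans (sumℚ-*ˡ ℓ g (picks rs)) (trans (cong (ℓ *_) (lagrange-sum rs u len dP)) (ℚₚ.*-zeroʳ ℓ))

record SeparablySplit (f : Poly) : Set where
  field
    roots       : List ℚ
    unique      : Unique roots
    nonconstant : 1 ≤ length roots
    degree      : Deg f (length roots)
    vanish      : All (Root f) roots

SeparablySplit-scale-prodL : ∀ {a₀ rs} → a₀ ≢ 0ℚ → Unique rs → 1 ≤ length rs →
  SeparablySplit (scaleP a₀ (prodL rs))
SeparablySplit-scale-prodL {a₀} {rs} a₀≢0 u 1≤l = record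
  { roots       = rs
  ; unique      = u
  ; nonconstant = 1≤l
  ; degree      = Deg-scale a₀≢0 (Deg-prodL rs)
  ; vanish      = All.tabulate λ {r} r∈rs →
      trans (evalP-scale a₀ (prodL rs) r) (trans (cong (a₀ *_) (prodL-root r∈rs)) (ℚₚ.*-zeroʳ a₀))
  }

SeparablySplit-fPoly : ∀ a₀ k (a : Fin k → ℚ) → a₀ ≢ 0ℚ → 1 ≤ k → Injective _≡_ _≡_ a →
  SeparablySplit (fPoly a₀ k a)
SeparablySplit-fPoly a₀ k a a₀≢0 1≤k a-inj = subst (λ p → SeparablySplit (scaleP a₀ p)) (sym (prodLin≡prodL k a))
  (SeparablySplit-scale-prodL a₀≢0 (Uniqueₚ.tabulate⁺ a-inj) (subst (1 ≤_) (sym (Listₚ.length-tabulate a)) 1≤k))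
  where
  prodLin≡prodL : ∀ k (a : Fin k → ℚ) → prodLin k a ≡ prodL (tabulate a)
  prodLin≡prodL zero    a = refl
  prodLin≡prodL (suc k) a = cong (linP (a Fin.zero) *P_) (prodLin≡prodL k (a ∘ Fin.suc))

split-nonconstant : ∀ {f} → SeparablySplit f → ∀ K → ¬ (∀ y → evalP f y ≡ K)
split-nonconstant {f} split K f≡K with SeparablySplit.roots split | SeparablySplit.nonconstant split
  | SeparablySplit.degree split | SeparablySplit.vanish split
... | r₀ ∷ rs | _ | lead≢0 , _ | fr₀≡0 ∷ _ =
  lead≢0 (evalP-injective {f} {[]} (λ y → trans (f≡K y) (trans (sym (f≡K r₀)) fr₀≡0)) (suc (length rs)))

split-inner-nonconstant : ∀ {f H} (g : ℚ → ℚ) → SeparablySplit f → (∀ y → evalP f y ≡ g (evalP H y)) →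
  Σ ℕ λ e → Deg H (suc e)
split-inner-nonconstant {f} {H} g split f≡g∘H with allZero⊎Deg H
... | inj₁ H≡0            = ⊥-elim (split-nonconstant split (g 0ℚ) λ y →
  trans (f≡g∘H y) (cong g (evalP-allZero H y H≡0)))
... | inj₂ (zero , _ , dH) = ⊥-elim (split-nonconstant split (g (coeff H 0)) λ y →
  trans (f≡g∘H y) (cong g (DegLe0-evalP H y dH)))
... | inj₂ (suc e , dH)    = e , dH

split-outer-nonconstant : ∀ {f φ} (h : ℚ → ℚ) → SeparablySplit f → (∀ y → evalP f y ≡ evalP φ (h y)) →
  Σ ℕ λ d → Deg φ (suc d)
split-outer-nonconstant {f} {φ} h split f≡φ∘h with allZero⊎Deg φ
... | inj₁ φ≡0            = ⊥-elim (split-nonconstant split 0ℚ λ y →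
  trans (f≡φ∘h y) (evalP-allZero φ (h y) φ≡0))
... | inj₂ (zero , _ , dφ) = ⊥-elim (split-nonconstant split (coeff φ 0) λ y →
  trans (f≡φ∘h y) (DegLe0-evalP φ (h y) dφ))
... | inj₂ (suc d , dφ)    = d , dφ

length-filter-∁ : ∀ {P : ℚ → Set} (P? : Decidable P) xs →
  length (filter P? xs) ℕ.+ length (filter (∁? P?) xs) ≡ length xs
length-filter-∁ P? []       = refl
length-filter-∁ P? (x ∷ xs) with P? x
... | yes _ = cong suc (length-filter-∁ P? xs)
... | no _  = trans (ℕₚ.+-suc _ _) (cong suc (length-filter-∁ P? xs))

evalP-≈comp : ∀ f φ H → f ≈P compP φ H → ∀ y → evalP f y ≡ evalP φ (evalP H y)
evalP-≈comp f φ H f≈φ∘H y = trans (evalP-cong {f} {compP φ H} y f≈φ∘H) (evalP-comp φ H y)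

-- If f = φ ∘ H has deg f distinct roots, the values of H at them are roots of φ; a fibre of H
-- over one such root c contains ≥ deg H of them, since the others are roots of (φ / (x - c)) ∘ H.
full-fibre : ∀ {f φ H M} → SeparablySplit f → f ≈P compP φ H → Deg H (suc M) →
  Σ ℚ λ c → Σ (List ℚ) λ rs → Unique rs × length rs ≡ suc M × All (λ r → evalP H r ≡ c) rs
full-fibre {f} {φ} {H} {M} split f≈φ∘H dH
  with split-outer-nonconstant (evalP H) split (evalP-≈comp f φ H f≈φ∘H)
     | SeparablySplit.roots split | SeparablySplit.unique split | SeparablySplit.nonconstant split
     | SeparablySplit.degree split | SeparablySplit.vanish split
... | d , dφ | roots@(r₀ ∷ _) | unique | _ | degree | vanish@(fr₀≡0 ∷ _) =
  c₀ , take (suc M) inFibre , Uniqueₚ.take⁺ (suc M) (Uniqueₚ.filter⁺ P? unique) ,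
  trans (Listₚ.length-take (suc M) inFibre) (ℕₚ.m≤n⇒m⊓n≡m enough-in-fibre) ,
  Allₚ.take⁺ (suc M) (Allₚ.all-filter P? roots)
  where
  f≡φ∘H : ∀ y → evalP f y ≡ evalP φ (evalP H y)
  f≡φ∘H = evalP-≈comp f φ H f≈φ∘H
  c₀ = evalP H r₀
  Q = compP (divLin c₀ φ) H
  f≡[H-c₀]Q : ∀ y → evalP f y ≡ (evalP H y - c₀) * evalP Q y
  f≡[H-c₀]Q y = trans (f≡φ∘H y) (trans (factor-theorem {φ} (trans (sym (f≡φ∘H r₀)) fr₀≡0) (evalP H y))
    (cong ((evalP H y - c₀) *_) (sym (evalP-comp (divLin c₀ φ) H y))))
  Q≢0 : ¬ allZero Q
  Q≢0 Q≡0 = split-nonconstant split 0ℚ λ y → trans (f≡[H-c₀]Q y)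
    (trans (cong ((evalP H y - c₀) *_) (evalP-allZero Q y Q≡0)) (ℚₚ.*-zeroʳ (evalP H y - c₀)))
  P? : Decidable (λ y → evalP H y ≡ c₀)
  P? y = evalP H y ℚₚ.≟ c₀
  inFibre  = filter P? roots
  outside  = filter (∁? P?) roots
  Q-roots : All (Root Q) outside
  Q-roots = All.zipWith
    (λ {y} (fy≡0 , Hy≢c₀) → x*y≡0⇒y≡0 (trans (sym (f≡[H-c₀]Q y)) fy≡0) (Hy≢c₀ ∘ x-y≡0⇒x≡y))
    (Allₚ.filter⁺ (∁? P?) vanish , Allₚ.all-filter (∁? P?) roots)
  few-outside : length outside ℕ.≤ d ℕ.* suc M
  few-outside = length-roots≤ outside Q≢0
    (DegLe-comp (DegLe-divLin c₀ φ (proj₂ dφ)) (proj₂ dH)) (Uniqueₚ.filter⁺ (∁? P?) unique) Q-roots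
  length-roots : length roots ≡ suc M ℕ.+ d ℕ.* suc M
  length-roots = Deg-unique degree (Deg-≈ (λ n → sym (f≈φ∘H n)) (Deg-comp dφ dH))
  enough-in-fibre : suc M ≤ length inFibre
  enough-in-fibre = ℕₚ.+-cancelʳ-≤ _ _ _ (begin
    suc M ℕ.+ length outside        ≤⟨ ℕₚ.+-monoʳ-≤ (suc M) few-outside ⟩
    suc M ℕ.+ d ℕ.* suc M           ≡⟨ sym length-roots ⟩
    length roots                    ≡⟨ sym (length-filter-∁ P? roots) ⟩
    length inFibre ℕ.+ length outside ∎)
    where open ℕₚ.≤-Reasoning

-- Cube factors

record CubeFactorisation (F : Poly) : Set where
  constructor cubeFactorisation
  field
    W V          : Poly
    d            : ℕ
    V-degree     : Deg V (suc d)
    factorises   : ∀ y → evalP F y ≡ evalP W y * evalP V y ^ℚ 3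

CubeFactorisation-power : ∀ {F} U V j → Deg V (suc m) →
  (∀ y → evalP F y ≡ evalP U y * evalP V y ^ℚ (3 ℕ.+ j)) → CubeFactorisation F
CubeFactorisation-power {m} {F} U V j dV F≡UV³⁺ʲ = cubeFactorisation (U *P V ^P j) V m dV λ y → begin
  evalP F y                                   ≡⟨ F≡UV³⁺ʲ y ⟩
  evalP U y * evalP V y ^ℚ (3 ℕ.+ j)          ≡⟨ cong (evalP U y *_) (^ℚ-+ (evalP V y) 3 j) ⟩
  evalP U y * (evalP V y ^ℚ 3 * evalP V y ^ℚ j) ≡⟨ solve 3 (λ u c r → u :* (c :* r) := u :* r :* c) refl
                                                   (evalP U y) (evalP V y ^ℚ 3) (evalP V y ^ℚ j) ⟩
  evalP U y * evalP V y ^ℚ j * evalP V y ^ℚ 3  ≡⟨ cong (_* evalP V y ^ℚ 3)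
                                                   (sym (trans (evalP-* U (V ^P j) y) (cong (evalP U y *_) (evalP-^ V j y)))) ⟩
  evalP (U *P V ^P j) y * evalP V y ^ℚ 3       ∎
  where open ≡-Reasoning

CubeFactorisation-comp : ∀ {F κ e} → CubeFactorisation F → Deg κ (suc e) → CubeFactorisation (compP F κ)
CubeFactorisation-comp {F} {κ} (cubeFactorisation W V d dV fact) dκ =
  cubeFactorisation (compP W κ) (compP V κ) _ (Deg-comp dV dκ) λ y →
    trans (evalP-comp F κ y) (trans (fact (evalP κ y))
      (sym (cong₂ (λ u v → u * v ^ℚ 3) (evalP-comp W κ y) (evalP-comp V κ y))))

≈-cube : ∀ {H} W V → (∀ y → evalP H y ≡ evalP W y * evalP V y ^ℚ 3) → H ≈P W *P (V *P (V *P V))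
≈-cube {H} W V H≡WV³ = evalP-injective {H} {W *P (V *P (V *P V))} λ y → begin
  evalP H y                                          ≡⟨ H≡WV³ y ⟩
  evalP W y * evalP V y ^ℚ 3
    ≡⟨ cong (evalP W y *_) (solve 1 (λ v → v :* (v :* (v :* con 1ℚ)) := v :* (v :* v)) refl (evalP V y)) ⟩
  evalP W y * (evalP V y * (evalP V y * evalP V y))
    ≡⟨ sym (cong (evalP W y *_) (trans (evalP-* V (V *P V) y) (cong (evalP V y *_) (evalP-* V V y)))) ⟩
  evalP W y * evalP (V *P (V *P V)) y                ≡⟨ sym (evalP-* W (V *P (V *P V)) y) ⟩
  evalP (W *P (V *P (V *P V))) y                     ∎
  where open ≡-Reasoning

-- deg H = w + 3 (d + 1), written as 2 + (w + (d + 1) + 2d) to exhibit the bound on cubeCofactor below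
Deg-cube : ∀ {H W V w d} → Deg W w → Deg V (suc d) → (∀ y → evalP H y ≡ evalP W y * evalP V y ^ℚ 3) →
  Deg H (suc (suc (w ℕ.+ suc d ℕ.+ (d ℕ.+ d))))
Deg-cube {H} {W} {V} {w} {d} dW dV H≡WV³ =
  subst (Deg H) (ℕ-solve 2 (λ w d → w ⊕ ((ncon 1 ⊕ d) ⊕ ((ncon 1 ⊕ d) ⊕ (ncon 1 ⊕ d)))
                               ⊜ ncon 2 ⊕ (w ⊕ (ncon 1 ⊕ d) ⊕ (d ⊕ d))) refl w d)
    (Deg-≈ (λ n → sym (≈-cube {H} W V H≡WV³ n)) (Deg-* dW (Deg-* dV (Deg-* dV dV))))

cubeCofactor : Poly → Poly → Poly
cubeCofactor W V = deriv W *P V +P scaleP (1ℚ + 1ℚ + 1ℚ) (W *P deriv V)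

DegLe-cubeCofactor : ∀ {W V w d} → Deg W w → Deg V (suc d) → DegLe (cubeCofactor W V) (w ℕ.+ suc d ℕ.+ (d ℕ.+ d))
DegLe-cubeCofactor {W} {V} {w} {d} (_ , dW) (_ , dV) = DegLe-mono (ℕₚ.m≤m+n (w ℕ.+ suc d) (d ℕ.+ d))
  (DegLe-+ (DegLe-* (DegLe-deriv W dW) dV) (DegLe-scale (1ℚ + 1ℚ + 1ℚ) (DegLe-* dW (DegLe-deriv V dV))))

evalP-deriv-cube : ∀ {H} W V → (∀ y → evalP H y ≡ evalP W y * evalP V y ^ℚ 3) →
  ∀ y → evalP (deriv H) y ≡ evalP V y * evalP V y * evalP (cubeCofactor W V) y
evalP-deriv-cube {H} W V H≡WV³ y = begin
  evalP (deriv H) y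
    ≡⟨ evalP-cong {deriv H} {deriv (W *P V³)} y (deriv-cong {H} {W *P V³} (≈-cube {H} W V H≡WV³)) ⟩
  evalP (deriv (W *P V³)) y
    ≡⟨ evalP-deriv-* W V³ y ⟩
  w′ * evalP V³ y + w * evalP (deriv V³) y
    ≡⟨ cong₂ (λ u u′ → w′ * u + w * u′) (trans (evalP-* V (V *P V) y) (cong (v *_) (evalP-* V V y)))
         (trans (evalP-deriv-* V (V *P V) y) (cong₂ (λ u u′ → v′ * u + v * u′) (evalP-* V V y) (evalP-deriv-* V V y))) ⟩
  w′ * (v * (v * v)) + w * (v′ * (v * v) + v * (v′ * v + v * v′))
    ≡⟨ solve 4 (λ w w′ v v′ → w′ :* (v :* (v :* v)) :+ w :* (v′ :* (v :* v) :+ v :* (v′ :* v :+ v :* v′))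
                            := v :* v :* (w′ :* v :+ (con 1ℚ :+ con 1ℚ :+ con 1ℚ) :* (w :* v′))) refl w w′ v v′ ⟩
  v * v * (w′ * v + (1ℚ + 1ℚ + 1ℚ) * (w * v′))
    ≡⟨ cong (v * v *_) (sym (trans (evalP-+ (deriv W *P V) (scaleP (1ℚ + 1ℚ + 1ℚ) (W *P deriv V)) y)
         (cong₂ _+_ (evalP-* (deriv W) V y) (trans (evalP-scale (1ℚ + 1ℚ + 1ℚ) (W *P deriv V) y)
           (cong ((1ℚ + 1ℚ + 1ℚ) *_) (evalP-* W (deriv V) y)))))) ⟩
  v * v * evalP (cubeCofactor W V) y ∎
  where
  open ≡-Reasoning
  V³ = V *P (V *P V)
  w = evalP W y
  w′ = evalP (deriv W) y
  v = evalP V y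
  v′ = evalP (deriv V) y

no-cube-fibre : ∀ {f φ H} → SeparablySplit f → f ≈P compP φ H → CubeFactorisation H → ⊥
no-cube-fibre {f} {φ} {H} split f≈φ∘H (cubeFactorisation W V d dV H≡WV³) with allZero⊎Deg W
... | inj₁ W≡0 = split-nonconstant split (evalP φ 0ℚ) λ y →
  trans (evalP-≈comp f φ H f≈φ∘H y) (cong (evalP φ) (trans (H≡WV³ y)
    (trans (cong (_* evalP V y ^ℚ 3) (evalP-allZero W y W≡0)) (ℚₚ.*-zeroˡ (evalP V y ^ℚ 3)))))
... | inj₂ (w , dW) =
  let dH = Deg-cube {H} dW dV H≡WV³
      _ , rs , unique , length-rs , fibre = full-fibre {f} {φ} {H} split f≈φ∘H dH
  in no-full-fibre {S = V} rs dH (DegLe-cubeCofactor dW dV) (evalP-deriv-cube {H} W V H≡WV³) unique length-rs fibre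

no-cube-factor : ∀ {f φ κ F} → SeparablySplit f → f ≈P compP φ (compP F κ) → CubeFactorisation F → ⊥
no-cube-factor {f} {φ} {κ} {F} split f≈ cube =
  let e , dκ = split-inner-nonconstant (evalP φ ∘ evalP F) split λ y →
                 trans (evalP-≈comp f φ (compP F κ) f≈ y) (cong (evalP φ) (evalP-comp F κ y))
  in no-cube-fibre {f} {φ} split f≈ (CubeFactorisation-comp {e = e} cube dκ)

CubeFactorisation-≈ : p ≈P q → CubeFactorisation p → CubeFactorisation q
CubeFactorisation-≈ {p} {q} p≈q (cubeFactorisation W V d dV fact) =
  cubeFactorisation W V d dV λ y → trans (sym (evalP-cong {p} {q} y p≈q)) (fact y)

CubeFactorisation-X^ : ∀ j → CubeFactorisation (X ^P (3 ℕ.+ j))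
CubeFactorisation-X^ j = CubeFactorisation-power (constP 1ℚ) X j Deg-X λ y → begin
  evalP (X ^P (3 ℕ.+ j)) y                      ≡⟨ evalP-X^ (3 ℕ.+ j) y ⟩
  y ^ℚ (3 ℕ.+ j)                                ≡⟨ sym (ℚₚ.*-identityˡ _) ⟩
  1ℚ * y ^ℚ (3 ℕ.+ j)                           ≡⟨ sym (cong₂ (λ u v → u * v ^ℚ (3 ℕ.+ j))
                                                     (evalP-const 1ℚ y) (evalP-X y)) ⟩
  evalP (constP 1ℚ) y * evalP X y ^ℚ (3 ℕ.+ j)  ∎
  where open ≡-Reasoning

evalP-scale-*-^ : ∀ α U V n y → evalP (scaleP α (U *P V ^P n)) y ≡ α * (evalP U y * evalP V y ^ℚ n)
evalP-scale-*-^ α U V n y = trans (evalP-scale α (U *P V ^P n) y)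
  (cong (α *_) (trans (evalP-* U (V ^P n) y) (cong (evalP U y *_) (evalP-^ V n y))))

CubeFactorisation-scale-*-^ : ∀ α U {V} j → Deg V (suc m) → CubeFactorisation (scaleP α (U *P V ^P (3 ℕ.+ j)))
CubeFactorisation-scale-*-^ α U {V} j dV = CubeFactorisation-power (scaleP α U) V j dV λ y → begin
  evalP (scaleP α (U *P V ^P (3 ℕ.+ j))) y       ≡⟨ evalP-scale-*-^ α U V (3 ℕ.+ j) y ⟩
  α * (evalP U y * evalP V y ^ℚ (3 ℕ.+ j))       ≡⟨ sym (ℚₚ.*-assoc α _ _) ⟩
  α * evalP U y * evalP V y ^ℚ (3 ℕ.+ j)         ≡⟨ sym (cong (_* evalP V y ^ℚ (3 ℕ.+ j)) (evalP-scale α U y)) ⟩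
  evalP (scaleP α U) y * evalP V y ^ℚ (3 ℕ.+ j)  ∎
  where open ≡-Reasoning

CubeFactorisation-scale-X^-* : ∀ α V i q → CubeFactorisation (scaleP α (X ^P (3 ℕ.+ i) *P V ^P q))
CubeFactorisation-scale-X^-* α V i q = CubeFactorisation-power (scaleP α (V ^P q)) X i Deg-X λ y → begin
  evalP (scaleP α (X ^P (3 ℕ.+ i) *P V ^P q)) y        ≡⟨ evalP-scale-*-^ α (X ^P (3 ℕ.+ i)) V q y ⟩
  α * (evalP (X ^P (3 ℕ.+ i)) y * evalP V y ^ℚ q)      ≡⟨ cong (λ u → α * (u * evalP V y ^ℚ q))
                                                          (evalP-X^ (3 ℕ.+ i) y) ⟩
  α * (y ^ℚ (3 ℕ.+ i) * evalP V y ^ℚ q)                ≡⟨ solve 3 (λ a z u → a :* (z :* u) := a :* u :* z) refl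
                                                          α (y ^ℚ (3 ℕ.+ i)) (evalP V y ^ℚ q) ⟩
  α * evalP V y ^ℚ q * y ^ℚ (3 ℕ.+ i)                  ≡⟨ sym (cong₂ (λ u w → u * w ^ℚ (3 ℕ.+ i))
                                                          (trans (evalP-scale α (V ^P q) y) (cong (α *_) (evalP-^ V q y)))
                                                          (evalP-X y)) ⟩
  evalP (scaleP α (V ^P q)) y * evalP X y ^ℚ (3 ℕ.+ i) ∎
  where open ≡-Reasoning

CubeFactorisation-[αX²-1]³ : ∀ {α} → α ≢ 0ℚ → CubeFactorisation ((scaleP α (X ^P 2) +P constP (- 1ℚ)) ^P 3)
CubeFactorisation-[αX²-1]³ {α} α≢0 = CubeFactorisation-power (constP 1ℚ) B 0 dB λ y → begin
  evalP (B ^P 3) y                      ≡⟨ evalP-^ B 3 y ⟩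
  evalP B y ^ℚ 3                        ≡⟨ sym (ℚₚ.*-identityˡ _) ⟩
  1ℚ * evalP B y ^ℚ 3                   ≡⟨ sym (cong (_* evalP B y ^ℚ 3) (evalP-const 1ℚ y)) ⟩
  evalP (constP 1ℚ) y * evalP B y ^ℚ 3  ∎
  where
  open ≡-Reasoning
  B = scaleP α (X ^P 2) +P constP (- 1ℚ)
  dB : Deg B 2
  dB = Deg-+ˡ (Deg-scale α≢0 (Deg-X^ 2)) (DegLe-mono z≤n (DegLe-const (- 1ℚ)))

CubeFactorisation-3X⁴-4X³ :
  CubeFactorisation (scaleP ((ℤ.+ 3) ℚ./ 1) (X ^P 4) +P scaleP (- ((ℤ.+ 4) ℚ./ 1)) (X ^P 3))
CubeFactorisation-3X⁴-4X³ = CubeFactorisation-power U X 0 Deg-X λ y → begin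
  evalP (scaleP three (X ^P 4) +P scaleP (- four) (X ^P 3)) y
    ≡⟨ evalP-+ (scaleP three (X ^P 4)) (scaleP (- four) (X ^P 3)) y ⟩
  evalP (scaleP three (X ^P 4)) y + evalP (scaleP (- four) (X ^P 3)) y
    ≡⟨ cong₂ _+_ (trans (evalP-scale three (X ^P 4) y) (cong (three *_) (evalP-X^ 4 y)))
                 (trans (evalP-scale (- four) (X ^P 3) y) (cong ((- four) *_) (evalP-X^ 3 y))) ⟩
  three * y ^ℚ 4 + (- four) * y ^ℚ 3
    ≡⟨ solve 3 (λ t f y → t :* (y :* (y :* (y :* (y :* con 1ℚ)))) :+ (:- f) :* (y :* (y :* (y :* con 1ℚ)))
                       := (t :* y :+ :- f) :* (y :* (y :* (y :* con 1ℚ)))) refl three four y ⟩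
  (three * y + - four) * y ^ℚ 3
    ≡⟨ sym (cong₂ (λ u w → u * w ^ℚ 3) (evalP-U y) (evalP-X y)) ⟩
  evalP U y * evalP X y ^ℚ 3 ∎
  where
  open ≡-Reasoning
  three four : ℚ
  three = (ℤ.+ 3) ℚ./ 1
  four  = (ℤ.+ 4) ℚ./ 1
  U = scaleP three X +P constP (- four)
  evalP-U : ∀ y → evalP U y ≡ three * y + - four
  evalP-U y = trans (evalP-+ (scaleP three X) (constP (- four)) y)
    (cong₂ _+_ (trans (evalP-scale three X y) (cong (three *_) (evalP-X y))) (evalP-const (- four) y))

-- Defs.deg tests the tail with a local helper that cannot be named here, so it can only be unfolded
-- one coefficient at a time, by case analysis on that coefficient; hence the bound deg≤2 below.
deg-allZero : ∀ p → allZero p → deg p ≡ 0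
deg-∷-allZero : ∀ a p → allZero p → deg (a ∷ p) ≡ 0
deg-allZero []      _ = refl
deg-allZero (a ∷ p) z = deg-∷-allZero a p (z ∘ suc)
deg-∷-allZero a []      _ = refl
deg-∷-allZero a (b ∷ p) z with b ℚₚ.≟ 0ℚ
... | no b≢0  = ⊥-elim (b≢0 (z 0))
... | yes refl rewrite trans (deg-∷-allZero 0ℚ p (z ∘ suc)) (sym (deg-allZero p (z ∘ suc))) =
  deg-∷-allZero a p (z ∘ suc)

deg-∷-∷ : ∀ a p → b ≢ 0ℚ → deg (a ∷ b ∷ p) ≡ suc (deg (b ∷ p))
deg-∷-∷ {b} a p b≢0 with b ℚₚ.≟ 0ℚ
... | yes b≡0 = ⊥-elim (b≢0 b≡0)
... | no _    = refl

deg-∷-0-∷ : ∀ a p → c ≢ 0ℚ → deg (a ∷ 0ℚ ∷ c ∷ p) ≡ suc (deg (0ℚ ∷ c ∷ p))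
deg-∷-0-∷ {c} a p c≢0 with c ℚₚ.≟ 0ℚ
... | yes c≡0 = ⊥-elim (c≢0 c≡0)
... | no _    = refl

deg≤2 : ∀ p → DegLe p 2 → deg p ≤ 2
deg≤2 []           _ = z≤n
deg≤2 (a ∷ [])     _ = z≤n
deg≤2 (a ∷ b ∷ []) _ with b ℚₚ.≟ 0ℚ
... | yes _ = z≤n
... | no _  = s≤s z≤n
deg≤2 (a ∷ b ∷ c ∷ p) d = by-cases (b ℚₚ.≟ 0ℚ) (c ℚₚ.≟ 0ℚ)
  where
  p≡0 : allZero p
  p≡0 n = vanishes d (3 ℕ.+ n) (s≤s (s≤s (s≤s z≤n)))
  deg[c∷p]≡0 : deg (c ∷ p) ≡ 0
  deg[c∷p]≡0 = deg-∷-allZero c p p≡0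
  by-cases : Dec (b ≡ 0ℚ) → Dec (c ≡ 0ℚ) → deg (a ∷ b ∷ c ∷ p) ≤ 2
  by-cases (yes b≡0) (yes c≡0) = ℕₚ.≤-trans (ℕₚ.≤-reflexive (deg-∷-allZero a (b ∷ c ∷ p) λ where
    0 → b≡0 ; 1 → c≡0 ; (suc (suc n)) → p≡0 n)) z≤n
  by-cases (no b≢0)  (yes c≡0) = ℕₚ.≤-trans (ℕₚ.≤-reflexive (trans (deg-∷-∷ a (c ∷ p) b≢0)
    (cong suc (deg-∷-allZero b (c ∷ p) λ where 0 → c≡0 ; (suc n) → p≡0 n)))) (s≤s z≤n)
  by-cases (no b≢0)  (no c≢0)  = ℕₚ.≤-reflexive (trans (deg-∷-∷ a (c ∷ p) b≢0)
    (cong suc (trans (deg-∷-∷ b p c≢0) (cong suc deg[c∷p]≡0))))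
  by-cases (yes b≡0) (no c≢0)  = subst (λ b → deg (a ∷ b ∷ c ∷ p) ≤ 2) (sym b≡0)
    (ℕₚ.≤-reflexive (trans (deg-∷-0-∷ a p c≢0) (cong suc (trans (deg-∷-∷ 0ℚ p c≢0) (cong suc deg[c∷p]≡0)))))

≤2⊎3+ : ∀ q → q ≤ 2 ⊎ Σ ℕ λ j → q ≡ 3 ℕ.+ j
≤2⊎3+ 0                     = inj₁ z≤n
≤2⊎3+ 1                     = inj₁ (s≤s z≤n)
≤2⊎3+ 2                     = inj₁ (s≤s (s≤s z≤n))
≤2⊎3+ (suc (suc (suc j)))   = inj₂ (j , refl)

DegLe-X^-≈ : ∀ {F q} → F ≈P X ^P q → DegLe F q
DegLe-X^-≈ {F} {q} F≈ = DegLe-≈ (sym ∘ F≈) (proj₂ (Deg-X^ q))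

DegLe-scale-X^-*-^ : ∀ α p q {v} → DegLe v 0 → DegLe (scaleP α (X ^P p *P v ^P q)) p
DegLe-scale-X^-*-^ α p q {v} dv = DegLe-scale α (subst (DegLe (X ^P p *P v ^P q)) (ℕₚ.+-identityʳ p)
  (DegLe-* (proj₂ (Deg-X^ p)) (subst (DegLe (v ^P q)) (ℕₚ.*-zeroʳ q) (DegLe-^ q dv))))

Conclusion : Poly → Poly → Set
Conclusion F G = ((StdPair1 F G ⊎ StdPair2 F G) × deg F ⊓ deg G ≤ 2) ⊎ (StdPair3 F G ⊎ StdPair4 F G)

standardPair-without-cube : ∀ {F G} → ¬ CubeFactorisation F → StandardPair F G → Conclusion F G
standardPair-without-cube {F} {G} no-cube = classify
  where
  ⊓≤2ˡ : DegLe F 2 → deg F ⊓ deg G ≤ 2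
  ⊓≤2ˡ d = ℕₚ.≤-trans (ℕₚ.m⊓n≤m (deg F) (deg G)) (deg≤2 F d)
  ⊓≤2ʳ : DegLe G 2 → deg F ⊓ deg G ≤ 2
  ⊓≤2ʳ d = ℕₚ.≤-trans (ℕₚ.m⊓n≤n (deg F) (deg G)) (deg≤2 G d)
  no-cube≈ : ∀ {C} → F ≈P C → ¬ CubeFactorisation C
  no-cube≈ F≈ = no-cube ∘ CubeFactorisation-≈ (sym ∘ F≈)
  classify : StandardPair F G → Conclusion F G
  classify (inj₁ (inj₁ k@(_ , q , _ , _ , _ , _ , _ , _ , _ , _ , F≈ , _))) with ≤2⊎3+ q
  ... | inj₁ q≤2       = inj₁ (inj₁ (inj₁ k) , ⊓≤2ˡ (DegLe-mono q≤2 (DegLe-X^-≈ F≈)))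
  ... | inj₂ (j , refl) = ⊥-elim (no-cube≈ F≈ (CubeFactorisation-X^ j))
  classify (inj₁ (inj₂ k@(α , q , p , v , _ , _ , _ , _ , v≢0 , _ , G≈ , F≈))) with ≤2⊎3+ q
  ... | inj₁ q≤2       = inj₁ (inj₁ (inj₂ k) , ⊓≤2ʳ (DegLe-mono q≤2 (DegLe-X^-≈ G≈)))
  ... | inj₂ (j , refl) with allZero⊎Deg v
  ...   | inj₁ v≡0           = ⊥-elim (v≢0 v≡0)
  ...   | inj₂ (suc _ , dv)  = ⊥-elim (no-cube≈ F≈ (CubeFactorisation-scale-*-^ α (X ^P p) j dv))
  ...   | inj₂ (zero , _ , dv) with ≤2⊎3+ p
  ...     | inj₂ (i , refl) = ⊥-elim (no-cube≈ F≈ (CubeFactorisation-scale-X^-* α v i (3 ℕ.+ j)))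
  ...     | inj₁ p≤2        =
    inj₁ (inj₁ (inj₂ k) , ⊓≤2ˡ (DegLe-mono p≤2 (DegLe-≈ (sym ∘ F≈) (DegLe-scale-X^-*-^ α p (3 ℕ.+ j) dv))))
  classify (inj₂ (inj₁ (inj₁ k@(_ , _ , _ , _ , _ , _ , F≈ , _)))) =
    inj₁ (inj₂ (inj₁ k) , ⊓≤2ˡ (DegLe-X^-≈ F≈))
  classify (inj₂ (inj₁ (inj₂ k@(_ , _ , _ , _ , _ , _ , G≈ , _)))) =
    inj₁ (inj₂ (inj₂ k) , ⊓≤2ʳ (DegLe-X^-≈ G≈))
  classify (inj₂ (inj₂ (inj₁ k)))        = inj₂ (inj₁ k)
  classify (inj₂ (inj₂ (inj₂ (inj₁ k)))) = inj₂ (inj₂ k)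
  classify (inj₂ (inj₂ (inj₂ (inj₂ (inj₁ (_ , α≢0 , F≈ , _)))))) =
    ⊥-elim (no-cube≈ F≈ (CubeFactorisation-[αX²-1]³ α≢0))
  classify (inj₂ (inj₂ (inj₂ (inj₂ (inj₂ (_ , _ , _ , F≈)))))) =
    ⊥-elim (no-cube≈ F≈ CubeFactorisation-3X⁴-4X³)

lemma3p2 : (a₀ : ℚ) (k : ℕ) (a : Fin k → ℚ) (g φ κ λ′ F G : Poly) →
    a₀ ≢ 0ℚ → 1 ≤ k → Injective _≡_ _≡_ a →
    InfManyBoundedDenom (fPoly a₀ k a) g →
    deg κ ≡ 1 → deg λ′ ≡ 1 →
    fPoly a₀ k a ≈P compP φ (compP F κ) →
    g ≈P compP φ (compP G λ′) →
    StandardPair F G →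
    InfManyBoundedDenom F G →
    ((StdPair1 F G ⊎ StdPair2 F G) × deg F ⊓ deg G ≤ 2)
      ⊎ (StdPair3 F G ⊎ StdPair4 F G)
lemma3p2 a₀ k a g φ κ λ′ F G a₀≢0 1≤k a-injective _ _ _ f≈φ∘F∘κ _ standard _ =
  standardPair-without-cube {F} {G}
    (no-cube-factor {φ = φ} {κ} {F} (SeparablySplit-fPoly a₀ k a a₀≢0 1≤k a-injective) f≈φ∘F∘κ)
    standard
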